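{- Let $n\ge2$ be even and let $\tau$ be any group automorphism of $\tilde S_n$ with $\tau(\{s_1,\dots,s_n\})=\{s_1,\dots,s_n\}$. Then $\tau$ preserves $\tilde I^{\mathsf{FPF}}_n$, and $\mathcal A^{\mathsf{FPF}}(\tau(z))=\{\tau(\pi):\pi\in\mathcal A^{\mathsf{FPF}}(z)\}$ for every $z\in\tilde I^{\mathsf{FPF}}_n$.
   Context: $\tilde S_n$ is the group of bijections $\pi:\mathbb Z\to\mathbb Z$ with $\pi(i+n)=\pi(i)+n$ and $\sum_{i=1}^n\pi(i)=\sum_{i=1}^n i$, a Coxeter group with generators $s_1,\dots,s_n$ ($s_i$ swaps $i+kn,i+1+kn$ for all $k$) and length $\ell$. $\tilde I^{\mathsf{FPF}}_n$ is the set of $z\in\tilde S_n$ with $z(z(i))=i\ne z(i)$ for all $i$. With $\Theta^+=s_1s_3\cdots s_{n-1}$, $\Theta^-=s_2s_4\cdots s_n$, each $z\in\tilde I^{\mathsf{FPF}}_n$ is conjugate to exactly one $\Theta\in\{\Theta^\pm\}$; $\mathcal A^{\mathsf{FPF}}(z)$ is the set of minimal-length elements of $\{w\in\tilde S_n:w^{ -1}\Theta w=z\}$. -}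

module Defs where

open import Data.Nat as ℕ using (ℕ; zero; suc; NonZero; _≡ᵇ_; _≤_; _/_)
open import Data.Integer as ℤ using (ℤ; +_; _+_; _-_; 0ℤ; 1ℤ; _%ℕ_)
open import Data.Bool using (if_then_else_)
open import Data.Fin using (Fin; toℕ)
open import Data.List using (List; []; _∷_; length; map; upTo; foldr)
open import Data.Product using (Σ; _×_; ∃)
open import Function using (_∘_; id)
open import Relation.Binary.PropositionalEquality using (_≡_)
open import Relation.Nullary using (¬_)

-- Permutations are (raw) functions ℤ → ℤ; products compose right-to-left:
-- (π σ)(i) = π (σ i).
Perm : Set
Perm = ℤ → ℤ

_≈_ : Perm → Perm → Set
f ≈ g = ∀ i → f i ≡ g i

sumTo : ℕ → (ℤ → ℤ) → ℤ
sumTo zero    g = 0ℤ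
sumTo (suc k) g = sumTo k g + g (+ suc k)

record IsAff (n : ℕ) (f : Perm) : Set where
  field
    injective  : ∀ i j → f i ≡ f j → i ≡ j
    surjective : ∀ j → ∃ λ i → f i ≡ j
    periodic   : ∀ i → f (i + + n) ≡ f i + + n
    sumCond    : sumTo n f ≡ sumTo n id

-- the simple generator s_i (1 ≤ i ≤ n): swaps i + kn and i + 1 + kn for all k
gen : (n : ℕ) .{{_ : NonZero n}} → ℕ → Perm
gen n i x =
  if (x %ℕ n) ≡ᵇ (i ℕ.% n) then x + 1ℤ
  else if (x %ℕ n) ≡ᵇ (suc i ℕ.% n) then x - 1ℤ
  else x

prodℕ : (n : ℕ) .{{_ : NonZero n}} → List ℕ → Perm
prodℕ n = foldr (λ i f → gen n i ∘ f) id

-- a word in the generators: an element k : Fin n stands for s_{k+1}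
wordProd : (n : ℕ) .{{_ : NonZero n}} → List (Fin n) → Perm
wordProd n ws = prodℕ n (map (λ k → suc (toℕ k)) ws)

HasWord : (n : ℕ) .{{_ : NonZero n}} → Perm → ℕ → Set
HasWord n w k = Σ (List (Fin n)) λ ws → (length ws ≡ k) × (wordProd n ws ≈ w)

-- ℓ(w) ≤ ℓ(v), with ℓ the Coxeter length (minimal word length)
LenLe : (n : ℕ) .{{_ : NonZero n}} → Perm → Perm → Set
LenLe n w v = ∀ k → HasWord n v k → Σ ℕ λ k' → (k' ≤ k) × HasWord n w k'

Θ⁺ : (n : ℕ) .{{_ : NonZero n}} → Perm
Θ⁺ n = prodℕ n (map (λ j → suc (2 ℕ.* j)) (upTo (n / 2)))

Θ⁻ : (n : ℕ) .{{_ : NonZero n}} → Perm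
Θ⁻ n = prodℕ n (map (λ j → 2 ℕ.+ 2 ℕ.* j) (upTo (n / 2)))

IsFPF : (n : ℕ) → Perm → Set
IsFPF n z = IsAff n z × (∀ i → z (z i) ≡ i) × (∀ i → ¬ (z i ≡ i))

-- w⁻¹ Θ w = z  (equivalently Θ w = w z, as w is invertible)
ConjBy : Perm → Perm → Perm → Set
ConjBy Θ w z = (Θ ∘ w) ≈ (w ∘ z)

-- the set {w ∈ S̃_n : w⁻¹ Θ w = z} for the (unique) Θ ∈ {Θ⁺, Θ⁻} conjugate to z
-- (taking the union over both Θ's is the same set, since only one of them is
-- conjugate to z)
InConjSet : (n : ℕ) .{{_ : NonZero n}} → Perm → Perm → Set
InConjSet n z w = IsAff n w × (ConjBy (Θ⁺ n) w z ⊎' ConjBy (Θ⁻ n) w z)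
  where
  open import Data.Sum using () renaming (_⊎_ to _⊎'_)

InAtoms : (n : ℕ) .{{_ : NonZero n}} → Perm → Perm → Set
InAtoms n z w = InConjSet n z w × (∀ v → InConjSet n z v → LenLe n w v)

IsSimple : (n : ℕ) .{{_ : NonZero n}} → Perm → Set
IsSimple n f = Σ (Fin n) λ k → f ≈ gen n (suc (toℕ k))

-- τ is a group automorphism of S̃_n (τ is given on all maps ℤ → ℤ, but only its
-- restriction to S̃_n matters)
record IsAutomorphism (n : ℕ) (τ : Perm → Perm) : Set where
  field
    closed     : ∀ f → IsAff n f → IsAff n (τ f)
    respects   : ∀ f g → IsAff n f → IsAff n g → f ≈ g → τ f ≈ τ g
    hom        : ∀ f g → IsAff n f → IsAff n g → τ (f ∘ g) ≈ (τ f ∘ τ g)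
    injective  : ∀ f g → IsAff n f → IsAff n g → τ f ≈ τ g → f ≈ g
    surjective : ∀ g → IsAff n g → Σ Perm λ f → IsAff n f × (τ f ≈ g)

PreservesSimple : (n : ℕ) .{{_ : NonZero n}} → (Perm → Perm) → Set
PreservesSimple n τ =
  (∀ f → IsAff n f → IsSimple n f → IsSimple n (τ f)) ×
  (∀ g → IsSimple n g → Σ Perm λ f → IsAff n f × IsSimple n f × (τ f ≈ g))

-- τ permutes the simple reflections and preserves which pairs of them commute, so on
-- generators it is a symmetry of the n-cycle of indices: τ(s_i) = s_{i+r} for all i, or
-- τ(s_i) = s_{r-i} for all i (indices mod n).  These are the conjugations by the bijections
-- x ↦ x + r and x ↦ r - x of ℤ, and since the s_i generate S̃_n (descent on
-- Σ_{y=1}^n (w(y) - y)², which drops by 2(w(j) - w(j+1)) when w is replaced by w s_j at a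
-- descent j), τ is conjugation by that bijection everywhere.  Conjugating by a bijection of ℤ
-- preserves fixed-point-free involutions; for even n it maps Θ⁺ = x ↦ x + ε x and
-- Θ⁻ = x ↦ x - ε x (ε the ±1 parity sign) to Θ⁺ and Θ⁻ in some order.  As τ is an
-- automorphism that permutes the generators, it also carries the conjugation sets onto each
-- other and preserves length, hence maps 𝒜^FPF(z) onto 𝒜^FPF(τ z).

module Submission where

open import Defs
open import Data.Nat as ℕ using (ℕ; zero; suc; NonZero; _≤_; _<_; z≤n; s≤s; _≡ᵇ_)
open import Data.Nat.Divisibility using (_∣_; divides)
import Data.Nat.Properties as ℕP
open import Data.Nat.DivMod using (m*n/n≡m)
open import Data.Integer as ℤ
  using (ℤ; +_; -[1+_]; _+_; _-_; _*_; -_; 0ℤ; 1ℤ; -1ℤ; _%ℕ_; _/ℕ_; ∣_∣)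
import Data.Integer.Properties as ℤP
open import Algebra.Properties.AbelianGroup ℤP.+-0-abelianGroup using (identityʳ-unique; x∙y⁻¹≈ε⇒x≈y)
open import Data.Integer.DivMod using (a≡a%ℕn+[a/ℕn]*n; n%ℕd<d)
open import Data.Integer.Tactic.RingSolver using (solve-∀)
open import Data.Bool using (true; false; if_then_else_)
open import Data.Fin using (Fin; toℕ; fromℕ<)
import Data.Fin.Properties as FP
open import Data.List using (List; []; _∷_; _∷ʳ_; map; upTo; applyUpTo)
open import Data.List.Relation.Unary.All using (All; []; _∷_)
import Data.List.Relation.Unary.All as All
import Data.List.Relation.Unary.All.Properties as All
import Data.List.Properties as LP
open import Data.Product using (Σ; ∃; _×_; _,_; proj₁; proj₂)
open import Data.Sum using (_⊎_; inj₁; inj₂)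
open import Function using (_∘_; id)
open import Relation.Binary.PropositionalEquality
open import Relation.Nullary using (¬_; Dec; yes; no; contradiction)
open import Relation.Binary.Definitions using (tri<; tri≈; tri>)
open ≡-Reasoning

module Modular (d : ℕ) .{{_ : NonZero d}} where

  infix 4 _≡ₘ_ _≡ₘ?_

  -- a record, so that x and y can be inferred from a proof of x ≡ₘ y
  record _≡ₘ_ (x y : ℤ) : Set where
    constructor mod-≡
    field %ℕ-≡ : x %ℕ d ≡ y %ℕ d
  open _≡ₘ_ public

  ≡ₘ-refl : ∀ {x} → x ≡ₘ x
  ≡ₘ-refl = mod-≡ refl

  ≡ₘ-sym : ∀ {x y} → x ≡ₘ y → y ≡ₘ x
  ≡ₘ-sym (mod-≡ e) = mod-≡ (sym e)

  ≡ₘ-trans : ∀ {x y z} → x ≡ₘ y → y ≡ₘ z → x ≡ₘ z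
  ≡ₘ-trans (mod-≡ e) (mod-≡ e') = mod-≡ (trans e e')

  _≡ₘ?_ : ∀ x y → Dec (x ≡ₘ y)
  x ≡ₘ? y with x %ℕ d ℕP.≟ y %ℕ d
  ... | yes e = yes (mod-≡ e)
  ... | no ne = no (ne ∘ %ℕ-≡)

  private
    d≤multiple : ∀ {a} b t → + a ≡ + b + + suc t * + d → d ≤ a
    d≤multiple {a} b t e = subst (d ≤_) (sym a≡) (ℕP.≤-trans (ℕP.m≤m+n d (t ℕ.* d)) (ℕP.m≤n+m _ b))
      where
      a≡ : a ≡ b ℕ.+ suc t ℕ.* d
      a≡ = ℤP.+-injective (trans e (trans (cong (λ v → + b + v) (sym (ℤP.pos-* (suc t) d))) (sym (ℤP.pos-+ b _))))

    negate-multiple : ∀ r r' t → + r ≡ + r' + -[1+ t ] * + d → + r' ≡ + r + + suc t * + d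
    negate-multiple r r' t e = begin
      + r'                                       ≡⟨ ring (+ r') (+ suc t) (+ d) ⟩
      + r' + - (+ suc t) * + d + + suc t * + d    ≡⟨ cong (_+ + suc t * + d) (sym e) ⟩
      + r + + suc t * + d                         ∎
      where ring : ∀ a k c → a ≡ a + (- k) * c + k * c
            ring = solve-∀

  remainder-unique : ∀ {r r'} k → r < d → r' < d → + r ≡ + r' + k * + d → r ≡ r'
  remainder-unique {r} {r'} (+ zero)   _   _    e = ℤP.+-injective (trans e (ℤP.+-identityʳ (+ r')))
  remainder-unique {r} {r'} (+ suc t)  r<d _    e = contradiction (d≤multiple r' t e) (ℕP.<⇒≱ r<d)
  remainder-unique {r} {r'} -[1+ t ]   _   r'<d e =
    contradiction (d≤multiple r t (negate-multiple r r' t e)) (ℕP.<⇒≱ r'<d)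

  private
    transpose : ∀ a b a' b' c → a + b * c ≡ a' + b' * c → a' ≡ a + (b - b') * c
    transpose a b a' b' c e = begin
      a'                        ≡⟨ ring₁ a' b' c ⟩
      a' + b' * c - b' * c      ≡⟨ cong (_- b' * c) (sym e) ⟩
      a + b * c - b' * c        ≡⟨ ring₂ a b b' c ⟩
      a + (b - b') * c          ∎
      where
      ring₁ : ∀ a b c → a ≡ a + b * c - b * c
      ring₁ = solve-∀
      ring₂ : ∀ a b b' c → a + b * c - b' * c ≡ a + (b - b') * c
      ring₂ = solve-∀

  %ℕ-unique : ∀ {x r} q → r < d → x ≡ + r + q * + d → x %ℕ d ≡ r
  %ℕ-unique {x} {r} q r<d e = sym (remainder-unique (x /ℕ d - q) r<d (n%ℕd<d x d)
    (transpose (+ (x %ℕ d)) (x /ℕ d) (+ r) q (+ d) (trans (sym (a≡a%ℕn+[a/ℕn]*n x d)) e)))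

  ≡ₘ⇒multiple : ∀ {x y} → x ≡ₘ y → ∃ λ k → x - y ≡ k * + d
  ≡ₘ⇒multiple {x} {y} (mod-≡ e) = x /ℕ d - y /ℕ d , (begin
    x - y                                                  ≡⟨ cong₂ _-_ (a≡a%ℕn+[a/ℕn]*n x d) (a≡a%ℕn+[a/ℕn]*n y d) ⟩
    (+ (x %ℕ d) + x /ℕ d * + d) - (+ (y %ℕ d) + y /ℕ d * + d) ≡⟨ cong (λ r → (+ r + x /ℕ d * + d) - (+ (y %ℕ d) + y /ℕ d * + d)) e ⟩
    (+ (y %ℕ d) + x /ℕ d * + d) - (+ (y %ℕ d) + y /ℕ d * + d) ≡⟨ ring (+ (y %ℕ d)) (x /ℕ d) (y /ℕ d) (+ d) ⟩
    (x /ℕ d - y /ℕ d) * + d                                   ∎)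
    where ring : ∀ r a b c → (r + a * c) - (r + b * c) ≡ (a - b) * c
          ring = solve-∀

  multiple⇒≡ₘ : ∀ {x y} k → x - y ≡ k * + d → x ≡ₘ y
  multiple⇒≡ₘ {x} {y} k e = mod-≡ (%ℕ-unique (y /ℕ d + k) (n%ℕd<d y d) (begin
    x                                       ≡⟨ ring x y ⟩
    y + (x - y)                             ≡⟨ cong₂ (λ a b → a + b) (a≡a%ℕn+[a/ℕn]*n y d) e ⟩
    + (y %ℕ d) + y /ℕ d * + d + k * + d     ≡⟨ ring′ (+ (y %ℕ d)) (y /ℕ d) k (+ d) ⟩
    + (y %ℕ d) + (y /ℕ d + k) * + d         ∎))
    where
    ring : ∀ x y → x ≡ y + (x - y)
    ring = solve-∀
    ring′ : ∀ r a b c → r + a * c + b * c ≡ r + (a + b) * c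
    ring′ = solve-∀

  ≡ₘ-by-difference : ∀ {x y} x' y' → x ≡ₘ y → x' - y' ≡ x - y → x' ≡ₘ y'
  ≡ₘ-by-difference _ _ x≡y e = let k , e' = ≡ₘ⇒multiple x≡y in multiple⇒≡ₘ k (trans e e')

  +-multiple-≡ₘ : ∀ x q → x + q * + d ≡ₘ x
  +-multiple-≡ₘ x q = multiple⇒≡ₘ q (ring x (q * + d))
    where ring : ∀ x a → x + a - x ≡ a
          ring = solve-∀

  +d-≡ₘ : ∀ x → x + + d ≡ₘ x
  +d-≡ₘ x = multiple⇒≡ₘ 1ℤ (ring x (+ d))
    where ring : ∀ x d → x + d - x ≡ 1ℤ * d
          ring = solve-∀

  gap-≢ₘ : ∀ {x y} t → 0 < t → t < d → x - y ≡ + t → ¬ x ≡ₘ y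
  gap-≢ₘ t 0<t t<d e x≡y =
    let k , e' = ≡ₘ⇒multiple x≡y
    in ℕP.<⇒≢ 0<t (sym (remainder-unique k t<d (ℕP.<-trans 0<t t<d) (trans (sym e) (trans e' (sym (ℤP.+-identityˡ _))))))

  ≡ₘ-+ʳ : ∀ {x y} → x ≡ₘ y → ∀ z → x + z ≡ₘ y + z
  ≡ₘ-+ʳ {x} {y} x≡y z = ≡ₘ-by-difference (x + z) (y + z) x≡y (ring x y z)
    where ring : ∀ x y z → (x + z) - (y + z) ≡ x - y
          ring = solve-∀

  ≡ₘ-+ˡ : ∀ z {x y} → x ≡ₘ y → z + x ≡ₘ z + y
  ≡ₘ-+ˡ z {x} {y} x≡y = ≡ₘ-by-difference (z + x) (z + y) x≡y (ring x y z)
    where ring : ∀ x y z → (z + x) - (z + y) ≡ x - y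
          ring = solve-∀

  ≡ₘ-remainder : ∀ x → x ≡ₘ + (x %ℕ d)
  ≡ₘ-remainder x = multiple⇒≡ₘ (x /ℕ d)
    (trans (cong (_- + (x %ℕ d)) (a≡a%ℕn+[a/ℕn]*n x d)) (ring (+ (x %ℕ d)) (x /ℕ d * + d)))
    where ring : ∀ r a → r + a - r ≡ a
          ring = solve-∀

module Parity where
  open Modular 2

  signOfRemainder : ℕ → ℤ
  signOfRemainder zero    = -1ℤ
  signOfRemainder (suc _) = 1ℤ

  ε : ℤ → ℤ
  ε x = signOfRemainder (x %ℕ 2)

  ε-resp-≡ₘ : ∀ {x y} → x ≡ₘ y → ε x ≡ ε y
  ε-resp-≡ₘ = cong signOfRemainder ∘ %ℕ-≡

  ε-+-even : ∀ x k → ε (x + k * + 2) ≡ ε x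
  ε-+-even x k = ε-resp-≡ₘ (+-multiple-≡ₘ x k)

  ε-±1 : ∀ x → ε x ≡ 1ℤ ⊎ ε x ≡ -1ℤ
  ε-±1 x with x %ℕ 2
  ... | zero  = inj₂ refl
  ... | suc _ = inj₁ refl

  ε-suc : ∀ x → ε (x + 1ℤ) ≡ - ε x
  ε-suc x = trans (ε-resp-≡ₘ (≡ₘ-+ʳ (≡ₘ-remainder x) 1ℤ))
                  (trans (remainder-case (x %ℕ 2) (n%ℕd<d x 2)) (cong -_ (ε-resp-≡ₘ (≡ₘ-sym (≡ₘ-remainder x)))))
    where
    remainder-case : ∀ r → r < 2 → ε (+ r + 1ℤ) ≡ - ε (+ r)
    remainder-case zero          _ = refl
    remainder-case (suc zero)    _ = refl
    remainder-case (suc (suc _)) (s≤s (s≤s ()))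

  ε-+ : ∀ x y → ε (x + y) ≡ - (ε x * ε y)
  ε-+ x y = trans (ε-resp-≡ₘ (≡ₘ-+ˡ x (≡ₘ-remainder y)))
                  (trans (remainder-case (y %ℕ 2) (n%ℕd<d y 2)) (cong (λ e → - (ε x * e)) (ε-resp-≡ₘ (≡ₘ-sym (≡ₘ-remainder y)))))
    where
    remainder-case : ∀ r → r < 2 → ε (x + + r) ≡ - (ε x * ε (+ r))
    remainder-case zero          _ = trans (cong ε (ℤP.+-identityʳ x)) (ring (ε x))
      where ring : ∀ a → a ≡ - (a * -1ℤ)
            ring = solve-∀
    remainder-case (suc zero)    _ = trans (ε-suc x) (cong -_ (sym (ℤP.*-identityʳ (ε x))))
    remainder-case (suc (suc _)) (s≤s (s≤s ()))

  ε-neg : ∀ x → ε (- x) ≡ ε x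
  ε-neg x = ε-resp-≡ₘ (multiple⇒≡ₘ { - x} {x} (- x) (ring x))
    where ring : ∀ x → - x - x ≡ - x * + 2
          ring = solve-∀

  ε-- : ∀ x y → ε (x - y) ≡ - (ε x * ε y)
  ε-- x y = trans (ε-+ x (- y)) (cong (λ e → - (ε x * e)) (ε-neg y))

module Isometries where
  open Parity

  data Isometry : Set where
    translation reflection : ℤ → Isometry

  ⟦_⟧ : Isometry → Perm
  ⟦ translation r ⟧ x = x + r
  ⟦ reflection r ⟧  x = r - x

  ⟦_⟧⁻¹ : Isometry → Perm
  ⟦ translation r ⟧⁻¹ x = x - r
  ⟦ reflection r ⟧⁻¹  x = r - x

  ⟦⟧⁻¹-inverseˡ : ∀ σ x → ⟦ σ ⟧⁻¹ (⟦ σ ⟧ x) ≡ x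
  ⟦⟧⁻¹-inverseˡ (translation r) x = ring x r
    where ring : ∀ x r → x + r - r ≡ x
          ring = solve-∀
  ⟦⟧⁻¹-inverseˡ (reflection r)  x = ring x r
    where ring : ∀ x r → r - (r - x) ≡ x
          ring = solve-∀

  ⟦⟧⁻¹-inverseʳ : ∀ σ x → ⟦ σ ⟧ (⟦ σ ⟧⁻¹ x) ≡ x
  ⟦⟧⁻¹-inverseʳ (translation r) x = ring x r
    where ring : ∀ x r → x - r + r ≡ x
          ring = solve-∀
  ⟦⟧⁻¹-inverseʳ (reflection r)  x = ⟦⟧⁻¹-inverseˡ (reflection r) x

  conjugate-involutive : ∀ σ {z} → (∀ i → z (z i) ≡ i) →
    ∀ i → (⟦ σ ⟧ ∘ z ∘ ⟦ σ ⟧⁻¹) ((⟦ σ ⟧ ∘ z ∘ ⟦ σ ⟧⁻¹) i) ≡ i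
  conjugate-involutive σ {z} z∘z≡id i = begin
    ⟦ σ ⟧ (z (⟦ σ ⟧⁻¹ (⟦ σ ⟧ (z (⟦ σ ⟧⁻¹ i)))))   ≡⟨ cong (⟦ σ ⟧ ∘ z) (⟦⟧⁻¹-inverseˡ σ _) ⟩
    ⟦ σ ⟧ (z (z (⟦ σ ⟧⁻¹ i)))                     ≡⟨ cong ⟦ σ ⟧ (z∘z≡id _) ⟩
    ⟦ σ ⟧ (⟦ σ ⟧⁻¹ i)                             ≡⟨ ⟦⟧⁻¹-inverseʳ σ i ⟩
    i                                             ∎

  conjugate-fixed-point-free : ∀ σ {z} → (∀ i → z i ≢ i) → ∀ i → (⟦ σ ⟧ ∘ z ∘ ⟦ σ ⟧⁻¹) i ≢ i
  conjugate-fixed-point-free σ {z} z-fpf i e =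
    z-fpf (⟦ σ ⟧⁻¹ i) (trans (sym (⟦⟧⁻¹-inverseˡ σ _)) (cong ⟦ σ ⟧⁻¹ e))

  Θ[_] : ℤ → Perm
  Θ[ κ ] x = x + κ * ε x

  orientation : Isometry → ℤ
  orientation (translation r) = - ε r
  orientation (reflection r)  = ε r

  orientation-±1 : ∀ σ → orientation σ ≡ 1ℤ ⊎ orientation σ ≡ -1ℤ
  orientation-±1 (translation r) with ε-±1 r
  ... | inj₁ e = inj₂ (cong -_ e)
  ... | inj₂ e = inj₁ (cong -_ e)
  orientation-±1 (reflection r) = ε-±1 r

  Θ-conjugate : ∀ σ κ → (⟦ σ ⟧ ∘ Θ[ κ ] ∘ ⟦ σ ⟧⁻¹) ≈ Θ[ orientation σ * κ ]
  Θ-conjugate (translation r) κ x = begin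
    x - r + κ * ε (x - r) + r          ≡⟨ cong (λ e → x - r + κ * e + r) (ε-- x r) ⟩
    x - r + κ * - (ε x * ε r) + r      ≡⟨ ring x r κ (ε x) (ε r) ⟩
    x + - ε r * κ * ε x                ∎
    where ring : ∀ x r κ a b → x - r + κ * - (a * b) + r ≡ x + - b * κ * a
          ring = solve-∀
  Θ-conjugate (reflection r) κ x = begin
    r - (r - x + κ * ε (r - x))        ≡⟨ cong (λ e → r - (r - x + κ * e)) (ε-- r x) ⟩
    r - (r - x + κ * - (ε r * ε x))    ≡⟨ ring x r κ (ε x) (ε r) ⟩
    x + ε r * κ * ε x                  ∎
    where ring : ∀ x r κ a b → r - (r - x + κ * - (b * a)) ≡ x + b * κ * a
          ring = solve-∀

private
  if-≡ᵇ : ∀ {A : Set} {a b} {p q : A} → a ≡ b → (if a ≡ᵇ b then p else q) ≡ p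
  if-≡ᵇ {a = a} {b} e with a ≡ᵇ b | ℕP.≡⇒≡ᵇ a b e
  ... | true | _ = refl

  if-≢ᵇ : ∀ {A : Set} {a b} {p q : A} → ¬ a ≡ b → (if a ≡ᵇ b then p else q) ≡ q
  if-≢ᵇ {a = a} {b} a≢b with a ≡ᵇ b | ℕP.≡ᵇ⇒≡ a b
  ... | true  | a≡b = contradiction (a≡b _) a≢b
  ... | false | _   = refl

module Swaps (n : ℕ) .{{_ : NonZero n}} (2≤n : 2 ≤ n) where
  open Modular n public
  open import Relation.Nullary.Decidable using (_⊎-dec_)

  inPair? : ∀ c x → Dec (x ≡ₘ c ⊎ x ≡ₘ 1ℤ + c)
  inPair? c x = (x ≡ₘ? c) ⊎-dec (x ≡ₘ? 1ℤ + c)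

  -- gen n i is definitionally swap (+ i), which is why the successor of c is written 1ℤ + c
  swap : ℤ → Perm
  swap c x = if x %ℕ n ≡ᵇ c %ℕ n then x + 1ℤ
             else if x %ℕ n ≡ᵇ (1ℤ + c) %ℕ n then x - 1ℤ
             else x

  gap-1-≢ₘ : ∀ {x y} → x - y ≡ 1ℤ → ¬ x ≡ₘ y
  gap-1-≢ₘ = gap-≢ₘ 1 (s≤s z≤n) 2≤n

  1+x≢ₘx : ∀ x → ¬ 1ℤ + x ≡ₘ x
  1+x≢ₘx x = gap-1-≢ₘ (ring x)
    where ring : ∀ x → 1ℤ + x - x ≡ 1ℤ
          ring = solve-∀

  swap-at : ∀ {c x} → x ≡ₘ c → swap c x ≡ x + 1ℤ
  swap-at x≡c = if-≡ᵇ (%ℕ-≡ x≡c)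

  swap-at-1+ : ∀ {c x} → ¬ x ≡ₘ c → x ≡ₘ 1ℤ + c → swap c x ≡ x - 1ℤ
  swap-at-1+ x≢c x≡1+c = trans (if-≢ᵇ (x≢c ∘ mod-≡)) (if-≡ᵇ (%ℕ-≡ x≡1+c))

  swap-off : ∀ {c x} → ¬ x ≡ₘ c → ¬ x ≡ₘ 1ℤ + c → swap c x ≡ x
  swap-off x≢c x≢1+c = trans (if-≢ᵇ (x≢c ∘ mod-≡)) (if-≢ᵇ (x≢1+c ∘ mod-≡))

  swap-resp-≡ₘ : ∀ {c c'} → c ≡ₘ c' → swap c ≈ swap c'
  swap-resp-≡ₘ {c} {c'} c≡c' x = cong₂ (λ a b → if x %ℕ n ≡ᵇ a then x + 1ℤ else if x %ℕ n ≡ᵇ b then x - 1ℤ else x)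
    (%ℕ-≡ c≡c') (%ℕ-≡ (≡ₘ-+ˡ 1ℤ c≡c'))

  private
    offset-≡ₘ : ∀ x c x' c' → x - c ≡ₘ x' - c' → x ≡ₘ c → x' ≡ₘ c'
    offset-≡ₘ x c x' c' e p =
      ≡ₘ-by-difference x' c' (≡ₘ-trans (≡ₘ-sym e) (≡ₘ-by-difference (x - c) 0ℤ p (ℤP.+-identityʳ (x - c))))
        (sym (ℤP.+-identityʳ (x' - c')))

    offset-≡ₘ-1+ : ∀ x c x' c' → x - c ≡ₘ x' - c' → x ≡ₘ 1ℤ + c → x' ≡ₘ 1ℤ + c'
    offset-≡ₘ-1+ x c x' c' e p =
      ≡ₘ-by-difference x' (1ℤ + c') (≡ₘ-trans (≡ₘ-sym e) (≡ₘ-by-difference (x - c) 1ℤ p (ring x c))) (sym (ring x' c'))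
      where ring : ∀ x c → x - c - 1ℤ ≡ x - (1ℤ + c)
            ring = solve-∀

  swap-displacement : ∀ c x c' x' → x - c ≡ₘ x' - c' → swap c x - x ≡ swap c' x' - x'
  swap-displacement c x c' x' e with x ≡ₘ? c | x ≡ₘ? 1ℤ + c
  ... | yes p | _ = begin
    swap c x - x     ≡⟨ cong (_- x) (swap-at p) ⟩
    x + 1ℤ - x       ≡⟨ ring-up x ⟩
    1ℤ               ≡⟨ ring-up x' ⟨
    x' + 1ℤ - x'     ≡⟨ cong (_- x') (swap-at (offset-≡ₘ x c x' c' e p)) ⟨
    swap c' x' - x'  ∎
    where ring-up : ∀ x → x + 1ℤ - x ≡ 1ℤ
          ring-up = solve-∀
  ... | no ¬p | yes q = begin
    swap c x - x     ≡⟨ cong (_- x) (swap-at-1+ ¬p q) ⟩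
    x - 1ℤ - x       ≡⟨ ring-down x ⟩
    -1ℤ              ≡⟨ ring-down x' ⟨
    x' - 1ℤ - x'     ≡⟨ cong (_- x') (swap-at-1+ (¬p ∘ offset-≡ₘ x' c' x c (≡ₘ-sym e)) (offset-≡ₘ-1+ x c x' c' e q)) ⟨
    swap c' x' - x'  ∎
    where ring-down : ∀ x → x - 1ℤ - x ≡ -1ℤ
          ring-down = solve-∀
  ... | no ¬p | no ¬q = begin
    swap c x - x     ≡⟨ cong (_- x) (swap-off ¬p ¬q) ⟩
    x - x            ≡⟨ ℤP.+-inverseʳ x ⟩
    0ℤ               ≡⟨ ℤP.+-inverseʳ x' ⟨
    x' - x'          ≡⟨ cong (_- x') (swap-off (¬p ∘ offset-≡ₘ x' c' x c (≡ₘ-sym e)) (¬q ∘ offset-≡ₘ-1+ x' c' x c (≡ₘ-sym e))) ⟨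
    swap c' x' - x'  ∎

  swap-by-displacement : ∀ c x c' x' → x - c ≡ₘ x' - c' → swap c x ≡ x + (swap c' x' - x')
  swap-by-displacement c x c' x' e = trans (ring (swap c x) x) (cong (_+_ x) (swap-displacement c x c' x' e))
    where ring : ∀ a x → a ≡ x + (a - x)
          ring = solve-∀

  swap-periodic : ∀ c x → swap c (x + + n) ≡ swap c x + + n
  swap-periodic c x = begin
    swap c (x + + n)                 ≡⟨ swap-by-displacement c (x + + n) c x (≡ₘ-+ʳ (+d-≡ₘ x) (- c)) ⟩
    x + + n + (swap c x - x)         ≡⟨ ring x (+ n) (swap c x) ⟩
    swap c x + + n                   ∎
    where ring : ∀ x n s → x + n + (s - x) ≡ s + n
          ring = solve-∀

  swap-translate : ∀ c r x → swap c (x - r) + r ≡ swap (c + r) x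
  swap-translate c r x = begin
    swap c (x - r) + r                   ≡⟨ cong (_+ r) (swap-by-displacement c (x - r) (c + r) x (mod-≡ (cong (_%ℕ n) (ring₁ x r c)))) ⟩
    x - r + (swap (c + r) x - x) + r     ≡⟨ ring₂ x r (swap (c + r) x) ⟩
    swap (c + r) x                       ∎
    where
    ring₁ : ∀ x r c → x - r - c ≡ x - (c + r)
    ring₁ = solve-∀
    ring₂ : ∀ x r s → x - r + (s - x) + r ≡ s
    ring₂ = solve-∀

  swap-reflect : ∀ c r x → r - swap c (r - x) ≡ swap (r - (1ℤ + c)) x
  swap-reflect c r x with x ≡ₘ? r - (1ℤ + c) | x ≡ₘ? 1ℤ + (r - (1ℤ + c))
  ... | yes p | _ = begin
    r - swap c (r - x)        ≡⟨ cong (_-_ r) (swap-at-1+ (λ q → 1+x≢ₘx c (≡ₘ-trans (≡ₘ-sym at-1+c) q)) at-1+c) ⟩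
    r - (r - x - 1ℤ)          ≡⟨ ring₁ r x ⟩
    x + 1ℤ                    ≡⟨ swap-at p ⟨
    swap (r - (1ℤ + c)) x     ∎
    where
    at-1+c : r - x ≡ₘ 1ℤ + c
    at-1+c = ≡ₘ-by-difference (r - x) (1ℤ + c) (≡ₘ-sym p) (ring₂ r x c)
      where ring₂ : ∀ r x c → r - x - (1ℤ + c) ≡ r - (1ℤ + c) - x
            ring₂ = solve-∀
    ring₁ : ∀ r x → r - (r - x - 1ℤ) ≡ x + 1ℤ
    ring₁ = solve-∀
  ... | no ¬p | yes q = begin
    r - swap c (r - x)        ≡⟨ cong (_-_ r) (swap-at at-c) ⟩
    r - (r - x + 1ℤ)          ≡⟨ ring₁ r x ⟩
    x - 1ℤ                    ≡⟨ swap-at-1+ ¬p q ⟨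
    swap (r - (1ℤ + c)) x     ∎
    where
    at-c : r - x ≡ₘ c
    at-c = ≡ₘ-by-difference (r - x) c (≡ₘ-sym q) (ring₂ r x c)
      where ring₂ : ∀ r x c → r - x - c ≡ 1ℤ + (r - (1ℤ + c)) - x
            ring₂ = solve-∀
    ring₁ : ∀ r x → r - (r - x + 1ℤ) ≡ x - 1ℤ
    ring₁ = solve-∀
  ... | no ¬p | no ¬q = begin
    r - swap c (r - x)        ≡⟨ cong (_-_ r) (swap-off (¬q ∘ from-c) (¬p ∘ from-1+c)) ⟩
    r - (r - x)               ≡⟨ ring₁ r x ⟩
    x                         ≡⟨ swap-off ¬p ¬q ⟨
    swap (r - (1ℤ + c)) x     ∎
    where
    from-c : r - x ≡ₘ c → x ≡ₘ 1ℤ + (r - (1ℤ + c))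
    from-c h = ≡ₘ-by-difference x (1ℤ + (r - (1ℤ + c))) (≡ₘ-sym h) (ring₂ r x c)
      where ring₂ : ∀ r x c → x - (1ℤ + (r - (1ℤ + c))) ≡ c - (r - x)
            ring₂ = solve-∀
    from-1+c : r - x ≡ₘ 1ℤ + c → x ≡ₘ r - (1ℤ + c)
    from-1+c h = ≡ₘ-by-difference x (r - (1ℤ + c)) (≡ₘ-sym h) (ring₂ r x c)
      where ring₂ : ∀ r x c → x - (r - (1ℤ + c)) ≡ 1ℤ + c - (r - x)
            ring₂ = solve-∀
    ring₁ : ∀ r x → r - (r - x) ≡ x
    ring₁ = solve-∀

  swap-involutive : ∀ c x → swap c (swap c x) ≡ x
  swap-involutive c x with x ≡ₘ? c | x ≡ₘ? 1ℤ + c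
  ... | yes p | _ = begin
    swap c (swap c x)   ≡⟨ cong (swap c) (swap-at p) ⟩
    swap c (x + 1ℤ)     ≡⟨ swap-at-1+ (λ q → 1+x≢ₘx c (≡ₘ-trans (≡ₘ-sym x+1≡1+c) q)) x+1≡1+c ⟩
    x + 1ℤ - 1ℤ         ≡⟨ ring x ⟩
    x                   ∎
    where
    x+1≡1+c : x + 1ℤ ≡ₘ 1ℤ + c
    x+1≡1+c = ≡ₘ-by-difference (x + 1ℤ) (1ℤ + c) p (ring′ x c)
      where ring′ : ∀ x c → x + 1ℤ - (1ℤ + c) ≡ x - c
            ring′ = solve-∀
    ring : ∀ x → x + 1ℤ - 1ℤ ≡ x
    ring = solve-∀
  ... | no ¬p | yes q = begin
    swap c (swap c x)   ≡⟨ cong (swap c) (swap-at-1+ ¬p q) ⟩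
    swap c (x - 1ℤ)     ≡⟨ swap-at (≡ₘ-by-difference (x - 1ℤ) c q (ring′ x c)) ⟩
    x - 1ℤ + 1ℤ         ≡⟨ ring x ⟩
    x                   ∎
    where
    ring′ : ∀ x c → x - 1ℤ - c ≡ x - (1ℤ + c)
    ring′ = solve-∀
    ring : ∀ x → x - 1ℤ + 1ℤ ≡ x
    ring = solve-∀
  ... | no ¬p | no ¬q = trans (cong (swap c) (swap-off ¬p ¬q)) (swap-off ¬p ¬q)

  swap-≤ : ∀ {c x} → ¬ x ≡ₘ c → swap c x ℤ.≤ x
  swap-≤ {c} {x} ¬p with x ≡ₘ? 1ℤ + c
  ... | yes q = subst (ℤ._≤ x) (sym (swap-at-1+ ¬p q)) (ℤP.i-j≤i x 1ℤ)
  ... | no ¬q = ℤP.≤-reflexive (swap-off ¬p ¬q)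

  ≤-swap : ∀ {c x} → ¬ x ≡ₘ 1ℤ + c → x ℤ.≤ swap c x
  ≤-swap {c} {x} ¬q with x ≡ₘ? c
  ... | yes p = subst (x ℤ.≤_) (sym (swap-at p)) (ℤP.i≤i+j x 1ℤ)
  ... | no ¬p = ℤP.≤-reflexive (sym (swap-off ¬p ¬q))

  swap-1+-noncomm : ∀ c → swap c (swap (1ℤ + c) (1ℤ + c)) ≢ swap (1ℤ + c) (swap c (1ℤ + c))
  -- the left side is at least 2 + c, the right side at most c
  swap-1+-noncomm c e = ℤP.<⇒≱ (ℤP.+-monoʳ-< x ℤ.-<+)
    (ℤP.≤-trans (≤-swap {c} {x + 1ℤ} (gap-1-≢ₘ (ring₁ x)))
      (ℤP.≤-trans (ℤP.≤-reflexive meet) (swap-≤ {x} {x - 1ℤ} (gap-1-≢ₘ (ring₂ x) ∘ ≡ₘ-sym))))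
    where
    x = 1ℤ + c
    ring₁ : ∀ x → x + 1ℤ - x ≡ 1ℤ
    ring₁ = solve-∀
    ring₂ : ∀ x → x - (x - 1ℤ) ≡ 1ℤ
    ring₂ = solve-∀
    meet : swap c (x + 1ℤ) ≡ swap x (x - 1ℤ)
    meet = trans (cong (swap c) (sym (swap-at {x} {x} ≡ₘ-refl))) (trans e (cong (swap x) (swap-at-1+ {c} {x} (1+x≢ₘx c) ≡ₘ-refl)))

  InPair : ℤ → ℤ → Set
  InPair c x = x ≡ₘ c ⊎ x ≡ₘ 1ℤ + c

  swap-in-pair : ∀ {c x} → InPair c x → InPair c (swap c x)
  swap-in-pair {c} {x} (inj₁ p) = inj₂ (subst (_≡ₘ 1ℤ + c) (sym (swap-at p)) (≡ₘ-by-difference (x + 1ℤ) (1ℤ + c) p (ring x c)))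
    where ring : ∀ x c → x + 1ℤ - (1ℤ + c) ≡ x - c
          ring = solve-∀
  swap-in-pair {c} {x} (inj₂ q) with x ≡ₘ? c
  ... | yes p = swap-in-pair (inj₁ p)
  ... | no ¬p = inj₁ (subst (_≡ₘ c) (sym (swap-at-1+ ¬p q)) (≡ₘ-by-difference (x - 1ℤ) c q (ring x c)))
    where ring : ∀ x c → x - 1ℤ - c ≡ x - (1ℤ + c)
          ring = solve-∀

  swap-off-pair : ∀ {c x} → ¬ InPair c x → swap c x ≡ x
  swap-off-pair ¬i = swap-off (¬i ∘ inj₁) (¬i ∘ inj₂)

  NonAdjacent : ℤ → ℤ → Set
  NonAdjacent a b = ¬ b ≡ₘ 1ℤ + a × ¬ a ≡ₘ 1ℤ + b

  pairs-disjoint : ∀ {a b x} → ¬ a ≡ₘ b → NonAdjacent a b → InPair a x → ¬ InPair b x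
  pairs-disjoint a≢b _ (inj₁ p) (inj₁ q) = a≢b (≡ₘ-trans (≡ₘ-sym p) q)
  pairs-disjoint a≢b (_ , a≢1+b) (inj₁ p) (inj₂ q) = a≢1+b (≡ₘ-trans (≡ₘ-sym p) q)
  pairs-disjoint a≢b (b≢1+a , _) (inj₂ p) (inj₁ q) = b≢1+a (≡ₘ-trans (≡ₘ-sym q) p)
  pairs-disjoint {a} {b} a≢b _ (inj₂ p) (inj₂ q) =
    a≢b (≡ₘ-by-difference a b (≡ₘ-trans (≡ₘ-sym p) q) (ring a b))
    where ring : ∀ a b → a - b ≡ (1ℤ + a) - (1ℤ + b)
          ring = solve-∀

  swap-comm : ∀ a b → NonAdjacent a b → ∀ x → swap a (swap b x) ≡ swap b (swap a x)
  swap-comm a b nonadj x with a ≡ₘ? b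
  ... | yes a≡b = trans (swap-resp-≡ₘ a≡b (swap b x)) (cong (swap b) (sym (swap-resp-≡ₘ a≡b x)))
  ... | no a≢b with inPair? a x | inPair? b x
  ... | yes ia | _ = trans (cong (swap a) (swap-off-pair (pairs-disjoint a≢b nonadj ia)))
                          (sym (swap-off-pair (pairs-disjoint a≢b nonadj (swap-in-pair ia))))
  ... | no _ | yes ib = trans (swap-off-pair (pairs-disjoint b≢a (proj₂ nonadj , proj₁ nonadj) (swap-in-pair ib)))
                              (cong (swap b) (sym (swap-off-pair (pairs-disjoint b≢a (proj₂ nonadj , proj₁ nonadj) ib))))
    where b≢a = a≢b ∘ ≡ₘ-sym
  ... | no ¬ia | no ¬ib = trans (cong (swap a) (swap-off-pair ¬ib))
                                (trans (swap-off-pair ¬ia) (sym (trans (cong (swap b) (swap-off-pair ¬ia)) (swap-off-pair ¬ib))))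

module Sums where

  sumTo-cong : ∀ k {F G : ℤ → ℤ} → (∀ j → 1 ≤ j → j ≤ k → F (+ j) ≡ G (+ j)) → sumTo k F ≡ sumTo k G
  sumTo-cong zero    _  = refl
  sumTo-cong (suc k) eq = cong₂ _+_ (sumTo-cong k (λ j 1≤j j≤k → eq j 1≤j (ℕP.m≤n⇒m≤1+n j≤k))) (eq (suc k) (s≤s z≤n) ℕP.≤-refl)

  sumTo-+ : ∀ k (F G : ℤ → ℤ) → sumTo k (λ y → F y + G y) ≡ sumTo k F + sumTo k G
  sumTo-+ zero    F G = refl
  sumTo-+ (suc k) F G = trans (cong (_+ (F (+ suc k) + G (+ suc k))) (sumTo-+ k F G)) (ring (sumTo k F) (sumTo k G) _ _)
    where ring : ∀ a b c d → a + b + (c + d) ≡ a + c + (b + d)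
          ring = solve-∀

  sumTo-const : ∀ k c → sumTo k (λ _ → c) ≡ + k * c
  sumTo-const zero    c = sym (ℤP.*-zeroˡ c)
  sumTo-const (suc k) c = trans (cong (_+ c) (sumTo-const k c)) (ring (+ k) c)
    where ring : ∀ k c → k * c + c ≡ (1ℤ + k) * c
          ring = solve-∀

  sumTo-telescope : ∀ k (g : ℤ → ℤ) → sumTo k (λ y → g (1ℤ + y) - g y) ≡ g (+ suc k) - g 1ℤ
  sumTo-telescope zero    g = sym (ℤP.+-inverseʳ (g 1ℤ))
  sumTo-telescope (suc k) g = trans (cong (_+ (g (+ suc (suc k)) - g (+ suc k))) (sumTo-telescope k g)) (ring (g (+ suc (suc k))) (g (+ suc k)) (g 1ℤ))
    where ring : ∀ a b c → b - c + (a - b) ≡ a - c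
          ring = solve-∀

  private
    below : ∀ {a k} → a ≤ suc k → a ≢ suc k → a ≤ k
    below a≤ a≢ = ℕP.≤-pred (ℕP.≤∧≢⇒< a≤ a≢)

  sumTo-one-point : ∀ k {F G : ℤ → ℤ} p → 1 ≤ p → p ≤ k →
    (∀ j → 1 ≤ j → j ≤ k → j ≢ p → F (+ j) ≡ G (+ j)) →
    sumTo k F ≡ sumTo k G + (F (+ p) - G (+ p))
  sumTo-one-point zero    p (s≤s _) () _
  sumTo-one-point (suc k) {F} {G} p 1≤p p≤k eq with p ℕP.≟ suc k
  ... | yes refl = trans (cong (_+ F (+ suc k)) (sumTo-cong k (λ j 1≤j j≤k → eq j 1≤j (ℕP.m≤n⇒m≤1+n j≤k) (ℕP.<⇒≢ (s≤s j≤k)))))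
                         (ring (sumTo k G) (F (+ suc k)) (G (+ suc k)))
    where ring : ∀ s a b → s + a ≡ s + b + (a - b)
          ring = solve-∀
  ... | no p≢ = trans (cong₂ _+_ (sumTo-one-point k p 1≤p (below p≤k p≢) (λ j 1≤j j≤k → eq j 1≤j (ℕP.m≤n⇒m≤1+n j≤k)))
                                  (eq (suc k) (s≤s z≤n) ℕP.≤-refl (p≢ ∘ sym)))
                      (ring (sumTo k G) (F (+ p) - G (+ p)) (G (+ suc k)))
    where ring : ∀ s d b → s + d + b ≡ s + b + d
          ring = solve-∀

  sumTo-two-points : ∀ k {F G : ℤ → ℤ} p q → 1 ≤ p → p ≤ k → 1 ≤ q → q ≤ k → p ≢ q →
    (∀ j → 1 ≤ j → j ≤ k → j ≢ p → j ≢ q → F (+ j) ≡ G (+ j)) →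
    sumTo k F ≡ sumTo k G + (F (+ p) - G (+ p)) + (F (+ q) - G (+ q))
  sumTo-two-points zero    p q (s≤s _) () _ _ _ _
  sumTo-two-points (suc k) {F} {G} p q 1≤p p≤k 1≤q q≤k p≢q eq with p ℕP.≟ suc k | q ℕP.≟ suc k
  ... | yes refl | _ = trans (cong (_+ F (+ suc k)) (sumTo-one-point k q 1≤q (below q≤k (p≢q ∘ sym))
                                (λ j 1≤j j≤k → eq j 1≤j (ℕP.m≤n⇒m≤1+n j≤k) (ℕP.<⇒≢ (s≤s j≤k)))))
                             (ring (sumTo k G) (F (+ q) - G (+ q)) (F (+ suc k)) (G (+ suc k)))
    where ring : ∀ s d a b → s + d + a ≡ s + b + (a - b) + d
          ring = solve-∀
  ... | no p≢ | yes refl = trans (cong (_+ F (+ suc k)) (sumTo-one-point k p 1≤p (below p≤k p≢)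
                                   (λ j 1≤j j≤k j≢p → eq j 1≤j (ℕP.m≤n⇒m≤1+n j≤k) j≢p (ℕP.<⇒≢ (s≤s j≤k)))))
                                 (ring (sumTo k G) (F (+ p) - G (+ p)) (F (+ suc k)) (G (+ suc k)))
    where ring : ∀ s d a b → s + d + a ≡ s + b + d + (a - b)
          ring = solve-∀
  ... | no p≢ | no q≢ = trans (cong₂ _+_ (sumTo-two-points k p q 1≤p (below p≤k p≢) 1≤q (below q≤k q≢) p≢q
                                           (λ j 1≤j j≤k → eq j 1≤j (ℕP.m≤n⇒m≤1+n j≤k)))
                                         (eq (suc k) (s≤s z≤n) ℕP.≤-refl (p≢ ∘ sym) (q≢ ∘ sym)))
                              (ring (sumTo k G) (F (+ p) - G (+ p)) (F (+ q) - G (+ q)) (G (+ suc k)))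
    where ring : ∀ s d e b → s + d + e + b ≡ s + b + d + e
          ring = solve-∀

  sumTo-nonneg : ∀ k (F : ℤ → ℤ) → (∀ j → 1 ≤ j → j ≤ k → 0ℤ ℤ.≤ F (+ j)) → 0ℤ ℤ.≤ sumTo k F
  sumTo-nonneg zero    F _   = ℤP.≤-refl
  sumTo-nonneg (suc k) F F≥0 =
    ℤP.+-mono-≤ (sumTo-nonneg k F (λ j 1≤j j≤k → F≥0 j 1≤j (ℕP.m≤n⇒m≤1+n j≤k))) (F≥0 (suc k) (s≤s z≤n) ℕP.≤-refl)

  private
    nonneg-sum≡0 : ∀ {a b} → 0ℤ ℤ.≤ a → 0ℤ ℤ.≤ b → a + b ≡ 0ℤ → a ≡ 0ℤ × b ≡ 0ℤ
    nonneg-sum≡0 {a} {b} 0≤a 0≤b a+b≡0 =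
      ℤP.≤-antisym (subst₂ ℤ._≤_ (ℤP.+-identityʳ a) a+b≡0 (ℤP.+-monoʳ-≤ a 0≤b)) 0≤a ,
      ℤP.≤-antisym (subst₂ ℤ._≤_ (ℤP.+-identityˡ b) a+b≡0 (ℤP.+-monoˡ-≤ b 0≤a)) 0≤b

  nonneg-sumTo≡0 : ∀ k (F : ℤ → ℤ) → (∀ j → 1 ≤ j → j ≤ k → 0ℤ ℤ.≤ F (+ j)) → sumTo k F ≡ 0ℤ →
    ∀ j → 1 ≤ j → j ≤ k → F (+ j) ≡ 0ℤ
  nonneg-sumTo≡0 zero    F _   _     j (s≤s _) ()
  nonneg-sumTo≡0 (suc k) F F≥0 sum≡0 j 1≤j j≤k
    with nonneg-sum≡0 (sumTo-nonneg k F (λ j 1≤j j≤k → F≥0 j 1≤j (ℕP.m≤n⇒m≤1+n j≤k))) (F≥0 (suc k) (s≤s z≤n) ℕP.≤-refl) sum≡0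
  ... | init≡0 , last≡0 with j ℕP.≟ suc k
  ... | yes refl = last≡0
  ... | no j≢ = nonneg-sumTo≡0 k F (λ j 1≤j j≤k → F≥0 j 1≤j (ℕP.m≤n⇒m≤1+n j≤k)) init≡0 j 1≤j (below j≤k j≢)

module Affine (n : ℕ) .{{_ : NonZero n}} (2≤n : 2 ≤ n) where
  open Swaps n 2≤n public
  open Sums

  Periodic : Perm → Set
  Periodic f = ∀ x → f (x + + n) ≡ f x + + n

  periodic-∘ : ∀ f g → Periodic f → Periodic g → Periodic (f ∘ g)
  periodic-∘ f g pf pg x = trans (cong f (pg x)) (pf (g x))

  private
    periodic-+ : ∀ f → Periodic f → ∀ x k → f (x + + k * + n) ≡ f x + + k * + n
    periodic-+ f pf x zero    = trans (cong f (ℤP.+-identityʳ x)) (sym (ℤP.+-identityʳ (f x)))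
    periodic-+ f pf x (suc k) = begin
      f (x + + suc k * + n)         ≡⟨ cong f (ring x (+ k) (+ n)) ⟩
      f (x + + k * + n + + n)       ≡⟨ pf _ ⟩
      f (x + + k * + n) + + n       ≡⟨ cong (_+ + n) (periodic-+ f pf x k) ⟩
      f x + + k * + n + + n         ≡⟨ ring (f x) (+ k) (+ n) ⟨
      f x + + suc k * + n           ∎
      where ring : ∀ x k n → x + (1ℤ + k) * n ≡ x + k * n + n
            ring = solve-∀

    periodic-- : ∀ f → Periodic f → ∀ x k → f (x - + k * + n) ≡ f x - + k * + n
    periodic-- f pf x zero    = trans (cong f (ℤP.+-identityʳ x)) (sym (ℤP.+-identityʳ (f x)))
    periodic-- f pf x (suc k) = begin
      f y                           ≡⟨ ring₁ (f y) (+ n) ⟩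
      f y + + n - + n               ≡⟨ cong (_- + n) (pf y) ⟨
      f (y + + n) - + n             ≡⟨ cong (λ v → f v - + n) (ring₂ x (+ k) (+ n)) ⟩
      f (x - + k * + n) - + n       ≡⟨ cong (_- + n) (periodic-- f pf x k) ⟩
      f x - + k * + n - + n         ≡⟨ ring₃ (f x) (+ k) (+ n) ⟩
      f x - + suc k * + n           ∎
      where
      y = x - + suc k * + n
      ring₁ : ∀ a n → a ≡ a + n - n
      ring₁ = solve-∀
      ring₂ : ∀ x k n → x - (1ℤ + k) * n + n ≡ x - k * n
      ring₂ = solve-∀
      ring₃ : ∀ a k n → a - k * n - n ≡ a - (1ℤ + k) * n
      ring₃ = solve-∀

  periodic-multiple : ∀ f → Periodic f → ∀ x q → f (x + q * + n) ≡ f x + q * + n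
  periodic-multiple f pf x (+ k)    = periodic-+ f pf x k
  periodic-multiple f pf x -[1+ k ] =
    trans (cong f (ring x (+ suc k) (+ n))) (trans (periodic-- f pf x (suc k)) (sym (ring (f x) (+ suc k) (+ n))))
    where ring : ∀ x k n → x + (- k) * n ≡ x - k * n
          ring = solve-∀

  InWindow : ℕ → Set
  InWindow j = 1 ≤ j × j ≤ n

  window-decomposition : ∀ x → Σ ℕ λ j → Σ ℤ λ q → InWindow j × x ≡ + j + q * + n
  window-decomposition x with x %ℕ n | n%ℕd<d x n | a≡a%ℕn+[a/ℕn]*n x n
  ... | zero  | _   | e = n , x /ℕ n - 1ℤ , (ℕP.≤-trans (s≤s z≤n) 2≤n , ℕP.≤-refl) , trans e (ring (x /ℕ n) (+ n))
    where ring : ∀ q n → + 0 + q * n ≡ n + (q - 1ℤ) * n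
          ring = solve-∀
  ... | suc r | r<n | e = suc r , x /ℕ n , (s≤s z≤n , ℕP.<⇒≤ r<n) , e

  periodic-ext : ∀ f g → Periodic f → Periodic g → (∀ j → InWindow j → f (+ j) ≡ g (+ j)) → f ≈ g
  periodic-ext f g pf pg agree x with window-decomposition x
  ... | j , q , w , refl = begin
    f (+ j + q * + n)    ≡⟨ periodic-multiple f pf (+ j) q ⟩
    f (+ j) + q * + n    ≡⟨ cong (_+ q * + n) (agree j w) ⟩
    g (+ j) + q * + n    ≡⟨ periodic-multiple g pg (+ j) q ⟨
    g (+ j + q * + n)    ∎

  private
    gap<n : ∀ {a b} → 1 ≤ a → b ≤ n → b ℕ.∸ a < n
    gap<n {suc a} {zero}  _ _   = ℕP.≤-trans (s≤s z≤n) 2≤n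
    gap<n {suc a} {suc b} _ b≤n = ℕP.<-≤-trans (s≤s (ℕP.m∸n≤m b a)) b≤n

    difference : ∀ {a b} → a ≤ b → + b - + a ≡ + (b ℕ.∸ a)
    difference {a} {b} a≤b = begin
      + b - + a                     ≡⟨ cong (λ v → + v - + a) (ℕP.m+[n∸m]≡n a≤b) ⟨
      + (a ℕ.+ (b ℕ.∸ a)) - + a     ≡⟨ cong (_- + a) (ℤP.pos-+ a (b ℕ.∸ a)) ⟩
      + a + + (b ℕ.∸ a) - + a       ≡⟨ ring (+ a) (+ (b ℕ.∸ a)) ⟩
      + (b ℕ.∸ a)                   ∎
      where ring : ∀ a d → a + d - a ≡ d
            ring = solve-∀

  window-≢ₘ : ∀ {a b} → InWindow a → InWindow b → a ≢ b → ¬ + a ≡ₘ + b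
  window-≢ₘ {a} {b} (1≤a , a≤n) (1≤b , b≤n) a≢b with ℕP.<-cmp a b
  ... | tri< a<b _ _ = gap-≢ₘ (b ℕ.∸ a) (ℕP.m<n⇒0<n∸m a<b) (gap<n 1≤a b≤n) (difference (ℕP.<⇒≤ a<b)) ∘ ≡ₘ-sym
  ... | tri≈ _ a≡b _ = contradiction a≡b a≢b
  ... | tri> _ _ b<a = gap-≢ₘ (a ℕ.∸ b) (ℕP.m<n⇒0<n∸m b<a) (gap<n 1≤b a≤n) (difference (ℕP.<⇒≤ b<a))

  -- s_j exchanges the window points j and partner, the window representative of j + 1
  record WindowSwap (j : ℕ) : Set where
    field
      partner        : ℕ
      partner-window : InWindow partner
      partner≢j      : partner ≢ j
      wrap           : ℤ
      suc-j≡partner  : + suc j ≡ + partner + wrap * + n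
      swap-j         : swap (+ j) (+ j) ≡ + suc j
      swap-partner   : swap (+ j) (+ partner) ≡ + partner - 1ℤ
      swap-elsewhere : ∀ y → InWindow y → y ≢ j → y ≢ partner → swap (+ j) (+ y) ≡ + y

  window-swap : ∀ j → InWindow j → WindowSwap j
  window-swap j jw@(1≤j , j≤n) with j ℕP.≟ n
  ... | no j≢n = record
    { partner        = suc j
    ; partner-window = s≤s z≤n , sj≤n
    ; partner≢j      = ℕP.1+n≢n
    ; wrap           = 0ℤ
    ; suc-j≡partner  = sym (ℤP.+-identityʳ (+ suc j))
    ; swap-j         = trans (swap-at {+ j} {+ j} ≡ₘ-refl) (ℤP.+-comm (+ j) 1ℤ)
    ; swap-partner   = swap-at-1+ (1+x≢ₘx (+ j)) ≡ₘ-refl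
    ; swap-elsewhere = λ y yw y≢j y≢sj → swap-off (window-≢ₘ yw jw y≢j) (window-≢ₘ yw (s≤s z≤n , sj≤n) y≢sj)
    }
    where sj≤n = ℕP.≤∧≢⇒< j≤n j≢n
  ... | yes refl = record
    { partner        = 1
    ; partner-window = ℕP.≤-refl , 1≤n
    ; partner≢j      = ℕP.<⇒≢ 2≤n
    ; wrap           = 1ℤ
    ; suc-j≡partner  = ring (+ n)
    ; swap-j         = trans (swap-at {+ n} {+ n} ≡ₘ-refl) (ℤP.+-comm (+ n) 1ℤ)
    ; swap-partner   = swap-at-1+ (window-≢ₘ (ℕP.≤-refl , 1≤n) jw (ℕP.<⇒≢ 2≤n)) (≡ₘ-sym 1+n≡1)
    ; swap-elsewhere = λ y yw y≢n y≢1 →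
        swap-off (window-≢ₘ yw jw y≢n) (window-≢ₘ yw (ℕP.≤-refl , 1≤n) y≢1 ∘ λ p → ≡ₘ-trans p 1+n≡1)
    }
    where
    1≤n = ℕP.≤-trans (s≤s z≤n) 2≤n
    ring : ∀ n → 1ℤ + n ≡ 1ℤ + 1ℤ * n
    ring = solve-∀
    1+n≡1 : 1ℤ + + n ≡ₘ 1ℤ
    1+n≡1 = +d-≡ₘ 1ℤ

  swap-window-sum : ∀ (Ψ : ℤ → ℤ → ℤ) f → Periodic f → ∀ j (jw : InWindow j) →
    let open WindowSwap (window-swap j jw) in
    sumTo n (λ y → Ψ y (f (swap (+ j) y))) ≡
      sumTo n (λ y → Ψ y (f y)) + (Ψ (+ j) (f (+ suc j)) - Ψ (+ j) (f (+ j)))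
                                + (Ψ (+ partner) (f (+ j) + (- wrap) * + n) - Ψ (+ partner) (f (+ partner)))
  swap-window-sum Ψ f pf j jw@(1≤j , j≤n) =
    trans (sumTo-two-points n j partner 1≤j j≤n (proj₁ partner-window) (proj₂ partner-window) (partner≢j ∘ sym)
             (λ y 1≤y y≤n y≢j y≢p → cong (Ψ (+ y) ∘ f) (swap-elsewhere y (1≤y , y≤n) y≢j y≢p)))
          (cong₂ (λ a b → sumTo n (λ y → Ψ y (f y)) + (Ψ (+ j) a - Ψ (+ j) (f (+ j))) + (Ψ (+ partner) b - Ψ (+ partner) (f (+ partner))))
                 (cong f swap-j) at-partner)
    where
    open WindowSwap (window-swap j jw)
    at-partner : f (swap (+ j) (+ partner)) ≡ f (+ j) + (- wrap) * + n
    at-partner = trans (cong f (trans swap-partner partner-1≡)) (periodic-multiple f pf (+ j) (- wrap))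
      where
      partner-1≡ : + partner - 1ℤ ≡ + j + (- wrap) * + n
      partner-1≡ = begin
        + partner - 1ℤ                              ≡⟨ ring₁ (+ partner) wrap (+ n) ⟩
        + partner + wrap * + n + (- wrap) * + n - 1ℤ ≡⟨ cong (λ v → v + (- wrap) * + n - 1ℤ) suc-j≡partner ⟨
        1ℤ + + j + (- wrap) * + n - 1ℤ              ≡⟨ ring₂ (+ j) wrap (+ n) ⟩
        + j + (- wrap) * + n                        ∎
        where
        ring₁ : ∀ p k n → p - 1ℤ ≡ p + k * n + (- k) * n - 1ℤ
        ring₁ = solve-∀
        ring₂ : ∀ j k n → 1ℤ + j + (- k) * n - 1ℤ ≡ j + (- k) * n
        ring₂ = solve-∀

  aff-id : IsAff n id
  aff-id = record { injective = λ _ _ e → e ; surjective = λ y → y , refl ; periodic = λ _ → refl ; sumCond = refl }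

  aff-∘gen : ∀ {f} i → InWindow i → IsAff n f → IsAff n (f ∘ gen n i)
  aff-∘gen {f} i iw af = record
    { injective  = λ x y e → trans (sym (swap-involutive (+ i) x))
                                   (trans (cong (swap (+ i)) (IsAff.injective af _ _ e)) (swap-involutive (+ i) y))
    ; surjective = λ y → let x , fx≡y = IsAff.surjective af y in swap (+ i) x , trans (cong f (swap-involutive (+ i) x)) fx≡y
    ; periodic   = periodic-∘ f (swap (+ i)) (IsAff.periodic af) (swap-periodic (+ i))
    ; sumCond    = begin
        sumTo n (f ∘ swap (+ i))         ≡⟨ swap-window-sum (λ _ v → v) f (IsAff.periodic af) i iw ⟩
        sumTo n f + (f (+ suc i) - f (+ i)) + (f (+ i) + (- wrap) * + n - f (+ partner))
                                         ≡⟨ cong (λ v → sumTo n f + (v - f (+ i)) + (f (+ i) + (- wrap) * + n - f (+ partner))) f[suc-i] ⟩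
        sumTo n f + (f (+ partner) + wrap * + n - f (+ i)) + (f (+ i) + (- wrap) * + n - f (+ partner))
                                         ≡⟨ ring (sumTo n f) (f (+ i)) (f (+ partner)) wrap (+ n) ⟩
        sumTo n f                        ≡⟨ IsAff.sumCond af ⟩
        sumTo n id                       ∎
    }
    where
    open WindowSwap (window-swap i iw)
    f[suc-i] : f (+ suc i) ≡ f (+ partner) + wrap * + n
    f[suc-i] = trans (cong f suc-j≡partner) (periodic-multiple f (IsAff.periodic af) (+ partner) wrap)
    ring : ∀ S a b k n → S + (b + k * n - a) + (a + (- k) * n - b) ≡ S
    ring = solve-∀

  aff-∘prodℕ : ∀ {L} → All InWindow L → ∀ {f} → IsAff n f → IsAff n (f ∘ prodℕ n L)
  aff-∘prodℕ []             af = af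
  aff-∘prodℕ (aw ∷ L-in-w) af = aff-∘prodℕ L-in-w (aff-∘gen _ aw af)

  aff-prodℕ : ∀ {L} → All InWindow L → IsAff n (prodℕ n L)
  aff-prodℕ L-in-w = aff-∘prodℕ L-in-w aff-id

  aff-gen : ∀ i → InWindow i → IsAff n (gen n i)
  aff-gen i iw = aff-∘gen i iw aff-id

  index-window : (k : Fin n) → InWindow (suc (toℕ k))
  index-window k = s≤s z≤n , FP.toℕ<n k

  aff-∘wordProd : ∀ ws {f} → IsAff n f → IsAff n (f ∘ wordProd n ws)
  aff-∘wordProd ws = aff-∘prodℕ (All.map⁺ (All.universal index-window ws))

  aff-wordProd : ∀ ws → IsAff n (wordProd n ws)
  aff-wordProd ws = aff-∘wordProd ws aff-id

  aff-resp-≈ : ∀ {f g} → f ≈ g → IsAff n f → IsAff n g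
  aff-resp-≈ {f} {g} f≈g af = record
    { injective  = λ x y e → IsAff.injective af x y (trans (f≈g x) (trans e (sym (f≈g y))))
    ; surjective = λ y → let x , fx≡y = IsAff.surjective af y in x , trans (sym (f≈g x)) fx≡y
    ; periodic   = λ x → trans (sym (f≈g _)) (trans (IsAff.periodic af x) (cong (_+ + n) (f≈g x)))
    ; sumCond    = trans (sumTo-cong n (λ j _ _ → sym (f≈g (+ j)))) (IsAff.sumCond af)
    }

  periodic-prodℕ : ∀ L → Periodic (prodℕ n L)
  periodic-prodℕ []      = λ _ → refl
  periodic-prodℕ (a ∷ L) = periodic-∘ (gen n a) (prodℕ n L) (swap-periodic (+ a)) (periodic-prodℕ L)

  prodℕ-∷ʳ : ∀ L a → prodℕ n (L ∷ʳ a) ≈ (prodℕ n L ∘ gen n a)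
  prodℕ-∷ʳ []      a x = refl
  prodℕ-∷ʳ (b ∷ L) a x = cong (gen n b) (prodℕ-∷ʳ L a x)

  wordProd-∷ʳ : ∀ ws k → wordProd n (ws ∷ʳ k) ≈ (wordProd n ws ∘ gen n (suc (toℕ k)))
  wordProd-∷ʳ []       k x = refl
  wordProd-∷ʳ (_ ∷ ws) k x = cong (gen n _) (wordProd-∷ʳ ws k x)

  private
    square-nonneg : ∀ x → 0ℤ ℤ.≤ x * x
    square-nonneg (+ k)    = subst (0ℤ ℤ.≤_) (ℤP.pos-* k k) (ℤ.+≤+ z≤n)
    square-nonneg -[1+ _ ] = ℤ.+≤+ z≤n

    nonneg⇒pos : ∀ {x} → 0ℤ ℤ.≤ x → Σ ℕ λ t → x ≡ + t
    nonneg⇒pos {+ t} _ = t , refl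

  Φ : Perm → ℤ
  Φ w = sumTo n (λ y → (w y - y) * (w y - y))

  Φ-nonneg : ∀ w → 0ℤ ℤ.≤ Φ w
  Φ-nonneg w = sumTo-nonneg n _ (λ j _ _ → square-nonneg (w (+ j) - + j))

  Φ-∘gen : ∀ w → Periodic w → ∀ j → InWindow j → Φ (w ∘ gen n j) ≡ Φ w + + 2 * (w (+ suc j) - w (+ j))
  Φ-∘gen w pw j jw = trans (swap-window-sum (λ y v → (v - y) * (v - y)) w pw j jw)
    (square-change (Φ w) (w (+ j)) (w (+ suc j)) (w (+ partner)) wrap (+ n) (+ j) (+ partner) suc-j≡partner
       (trans (cong w suc-j≡partner) (periodic-multiple w pw (+ partner) wrap)))
    where
    open WindowSwap (window-swap j jw)
    sq : ℤ → ℤ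
    sq x = x * x
    square-change : ∀ S A B Wp K N J P → 1ℤ + J ≡ P + K * N → B ≡ Wp + K * N →
        S + (sq (B - J) - sq (A - J)) + (sq (A + (- K) * N - P) - sq (Wp - P)) ≡ S + + 2 * (B - A)
    square-change S A B Wp K N J P e refl = trans (cong (λ P → S + (sq (Wp + K * N - J) - sq (A - J)) + (sq (A + (- K) * N - P) - sq (Wp - P))) P≡)
                                      (ring′ S A Wp K N J)
      where
      P≡ : P ≡ 1ℤ + J - K * N
      P≡ = trans (ring″ P K N) (cong (_- K * N) (sym e))
        where ring″ : ∀ P K N → P ≡ P + K * N - K * N
              ring″ = solve-∀
      ring′ : ∀ S A Wp K N J →
           S + ((Wp + K * N - J) * (Wp + K * N - J) - (A - J) * (A - J))
             + ((A + (- K) * N - (1ℤ + J - K * N)) * (A + (- K) * N - (1ℤ + J - K * N)) - (Wp - (1ℤ + J - K * N)) * (Wp - (1ℤ + J - K * N)))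
           ≡ S + + 2 * (Wp + K * N - A)
      ring′ = solve-∀

  Φ-descent : ∀ w → Periodic w → ∀ j → InWindow j → w (+ suc j) ℤ.< w (+ j) → ∣ Φ (w ∘ gen n j) ∣ < ∣ Φ w ∣
  Φ-descent w pw j jw lt with nonneg⇒pos (Φ-nonneg (w ∘ gen n j)) | nonneg⇒pos (ℤP.i≤j⇒0≤j-i (ℤP.i<j⇒suc[i]≤j lt))
  ... | a , Φ′≡a | t , gap≡t = subst₂ (λ u v → ∣ u ∣ < ∣ v ∣) (sym Φ′≡a) Φw≡ (ℕP.m<m+n a (s≤s z≤n))
    where
    A = w (+ j)
    B = w (+ suc j)
    Φw≡ : + a + + 2 * + suc t ≡ Φ w
    Φw≡ = begin
      + a + + 2 * (1ℤ + + t)                                ≡⟨ cong₂ (λ u v → u + + 2 * (1ℤ + v)) (sym Φ′≡a) (sym gap≡t) ⟩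
      Φ (w ∘ gen n j) + + 2 * (1ℤ + (A - (1ℤ + B)))         ≡⟨ cong (λ u → u + + 2 * (1ℤ + (A - (1ℤ + B)))) (Φ-∘gen w pw j jw) ⟩
      Φ w + + 2 * (B - A) + + 2 * (1ℤ + (A - (1ℤ + B)))     ≡⟨ ring (Φ w) A B ⟩
      Φ w                                                   ∎
      where ring : ∀ S A B → S + + 2 * (B - A) + + 2 * (1ℤ + (A - (1ℤ + B))) ≡ S
            ring = solve-∀

  ascending⇒≈id : ∀ w → IsAff n w → (∀ j → InWindow j → w (+ j) ℤ.≤ w (+ suc j)) → w ≈ id
  ascending⇒≈id w aw asc = periodic-ext w id (IsAff.periodic aw) (λ _ → refl)
    (λ j (1≤j , j≤n) → trans (on-window j 1≤j j≤n) (trans (cong (_+_ (+ j)) c≡0) (ℤP.+-identityʳ (+ j))))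
    where
    excess : ℤ → ℤ
    excess y = w (1ℤ + y) - (1ℤ + w y)

    excess≥0 : ∀ j → 1 ≤ j → j ≤ n → 0ℤ ℤ.≤ excess (+ j)
    excess≥0 j 1≤j j≤n = ℤP.i≤j⇒0≤j-i (ℤP.i<j⇒suc[i]≤j (ℤP.≤∧≢⇒< (asc j (1≤j , j≤n)) w[j]≢w[1+j]))
      where
      w[j]≢w[1+j] : w (+ j) ≢ w (+ suc j)
      w[j]≢w[1+j] e = ℕP.1+n≢n (sym (ℤP.+-injective (IsAff.injective aw _ _ e)))

    excess-sum : sumTo n excess ≡ 0ℤ
    excess-sum = begin
      sumTo n excess                                        ≡⟨ sumTo-cong n (λ j _ _ → ring₁ (w (1ℤ + + j)) (w (+ j))) ⟩
      sumTo n (λ y → (w (1ℤ + y) - w y) + -1ℤ)              ≡⟨ sumTo-+ n (λ y → w (1ℤ + y) - w y) (λ _ → -1ℤ) ⟩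
      sumTo n (λ y → w (1ℤ + y) - w y) + sumTo n (λ _ → -1ℤ) ≡⟨ cong₂ _+_ (sumTo-telescope n w) (sumTo-const n -1ℤ) ⟩
      w (1ℤ + + n) - w 1ℤ + + n * -1ℤ                       ≡⟨ cong (λ v → v - w 1ℤ + + n * -1ℤ) (IsAff.periodic aw 1ℤ) ⟩
      w 1ℤ + + n - w 1ℤ + + n * -1ℤ                         ≡⟨ ring₂ (w 1ℤ) (+ n) ⟩
      0ℤ                                                    ∎
      where
      ring₁ : ∀ b a → b - (1ℤ + a) ≡ b - a + -1ℤ
      ring₁ = solve-∀
      ring₂ : ∀ a n → a + n - a + n * -1ℤ ≡ 0ℤ
      ring₂ = solve-∀

    w[1+j]≡1+w[j] : ∀ j → 1 ≤ j → j ≤ n → w (+ suc j) ≡ 1ℤ + w (+ j)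
    w[1+j]≡1+w[j] j 1≤j j≤n = x∙y⁻¹≈ε⇒x≈y _ _ (nonneg-sumTo≡0 n excess excess≥0 excess-sum j 1≤j j≤n)

    c : ℤ
    c = w 1ℤ - 1ℤ

    on-window : ∀ j → 1 ≤ j → j ≤ n → w (+ j) ≡ + j + c
    on-window (suc zero)    _ _   = ring (w 1ℤ)
      where ring : ∀ a → a ≡ 1ℤ + (a - 1ℤ)
            ring = solve-∀
    on-window (suc (suc j)) _ j≤n = begin
      w (+ suc (suc j))          ≡⟨ w[1+j]≡1+w[j] (suc j) (s≤s z≤n) (ℕP.<⇒≤ j≤n) ⟩
      1ℤ + w (+ suc j)           ≡⟨ cong (_+_ 1ℤ) (on-window (suc j) (s≤s z≤n) (ℕP.<⇒≤ j≤n)) ⟩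
      1ℤ + (1ℤ + + j + c)        ≡⟨ ring (+ j) c ⟩
      1ℤ + (1ℤ + + j) + c        ∎
      where ring : ∀ j c → 1ℤ + (1ℤ + j + c) ≡ 1ℤ + (1ℤ + j) + c
            ring = solve-∀

    c≡0 : c ≡ 0ℤ
    c≡0 = ℤP.*-cancelˡ-≡ (+ n) c 0ℤ (trans (identityʳ-unique (sumTo n id) (+ n * c) nc) (sym (ℤP.*-zeroʳ (+ n))))
      where
      nc : sumTo n id + + n * c ≡ sumTo n id
      nc = begin
        sumTo n id + + n * c                  ≡⟨ cong (_+_ (sumTo n id)) (sumTo-const n c) ⟨
        sumTo n id + sumTo n (λ _ → c)        ≡⟨ sumTo-+ n id (λ _ → c) ⟨
        sumTo n (λ y → y + c)                 ≡⟨ sumTo-cong n (λ j 1≤j j≤n → on-window j 1≤j j≤n) ⟨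
        sumTo n w                             ≡⟨ IsAff.sumCond aw ⟩
        sumTo n id                            ∎

  private
    generated : ∀ m w → IsAff n w → ∣ Φ w ∣ < m → Σ (List (Fin n)) λ ws → wordProd n ws ≈ w
    generated (suc m) w aw Φ<m with FP.any? (λ k → w (+ suc (suc (toℕ k))) ℤP.<? w (+ suc (toℕ k)))
    ... | yes (k , descent) =
      let ws , ws≈ = generated m (w ∘ gen n j) (aff-∘gen j jw aw)
                       (ℕP.<-≤-trans (Φ-descent w (IsAff.periodic aw) j jw descent) (ℕP.≤-pred Φ<m))
      in ws ∷ʳ k , λ x → trans (wordProd-∷ʳ ws k x) (trans (ws≈ (gen n j x)) (cong w (swap-involutive (+ j) x)))
      where
      j = suc (toℕ k)
      jw = index-window k
    ... | no ¬descent = [] , λ x → sym (ascending⇒≈id w aw ascending x)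
      where
      ascending : ∀ j → InWindow j → w (+ j) ℤ.≤ w (+ suc j)
      ascending (suc j) (_ , j<n) = ℤP.≮⇒≥ λ lt →
        ¬descent (fromℕ< j<n , subst (λ i → w (+ suc (suc i)) ℤ.< w (+ suc i)) (sym (FP.toℕ-fromℕ< j<n)) lt)

  generated-by-words : ∀ w → IsAff n w → Σ (List (Fin n)) λ ws → wordProd n ws ≈ w
  generated-by-words w aw = generated (suc ∣ Φ w ∣) w aw ℕP.≤-refl

  aff-∘ : ∀ {f g} → IsAff n f → IsAff n g → IsAff n (f ∘ g)
  aff-∘ {f} {g} af ag =
    let ws , ws≈g = generated-by-words g ag
    in aff-resp-≈ (cong f ∘ ws≈g) (aff-∘wordProd ws af)

module Theta (n : ℕ) .{{_ : NonZero n}} (2≤n : 2 ≤ n) (m : ℕ) (n≡2m : n ≡ 2 ℕ.* m) where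
  open Affine n 2≤n
  open Parity
  open Isometries using (Θ[_])

  private
    ε-odd : ∀ c → ε (+ suc (2 ℕ.* c)) ≡ 1ℤ
    ε-odd c = trans (cong (λ v → ε (1ℤ + v)) (trans (cong +_ (ℕP.*-comm 2 c)) (ℤP.pos-* c 2))) (ε-+-even 1ℤ (+ c))

    ε-even : ∀ c → ε (+ suc (suc (2 ℕ.* c))) ≡ -1ℤ
    ε-even c = trans (cong ε (ℤP.+-comm 1ℤ (+ suc (2 ℕ.* c)))) (trans (ε-suc (+ suc (2 ℕ.* c))) (cong -_ (ε-odd c)))

    gen-at : ∀ a → gen n a (+ a) ≡ + suc a
    gen-at a = trans (swap-at {+ a} {+ a} ≡ₘ-refl) (ℤP.+-comm (+ a) 1ℤ)

    gen-at-suc : ∀ a → gen n a (+ suc a) ≡ + a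
    gen-at-suc a = trans (swap-at-1+ (1+x≢ₘx (+ a)) ≡ₘ-refl) (ring (+ a))
      where ring : ∀ a → 1ℤ + a - 1ℤ ≡ a
            ring = solve-∀

    gen-elsewhere : ∀ a y → 1 ≤ a → suc a ≤ n → InWindow y → y ≢ a → y ≢ suc a → gen n a (+ y) ≡ + y
    gen-elsewhere a y 1≤a a<n yw y≢a y≢sa =
      swap-off (window-≢ₘ yw (1≤a , ℕP.<⇒≤ a<n) y≢a) (window-≢ₘ yw (s≤s z≤n , a<n) y≢sa)

    ≤-cases : ∀ {y c} → y ≤ suc (suc c) → y ≤ c ⊎ y ≡ suc c ⊎ y ≡ suc (suc c)
    ≤-cases y≤ with ℕP.m≤n⇒m<n∨m≡n y≤
    ... | inj₂ e  = inj₂ (inj₂ e)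
    ... | inj₁ (s≤s y≤) with ℕP.m≤n⇒m<n∨m≡n y≤
    ...   | inj₁ (s≤s y≤c) = inj₁ y≤c
    ...   | inj₂ e         = inj₂ (inj₁ e)

  oddIndices : ℕ → List ℕ
  oddIndices c = applyUpTo (λ i → suc (2 ℕ.* i)) c

  odd-product : ∀ c → 2 ℕ.* c ≤ n →
    (∀ y → 1 ≤ y → y ≤ 2 ℕ.* c → prodℕ n (oddIndices c) (+ y) ≡ + y + ε (+ y)) ×
    (∀ y → 2 ℕ.* c < y → y ≤ n → prodℕ n (oddIndices c) (+ y) ≡ + y)
  odd-product zero    _ = (λ { _ (s≤s _) () }) , (λ _ _ _ → refl)
  odd-product (suc c) 2[1+c]≤n = paired , fixed
    where
    a = suc (2 ℕ.* c)
    a<n : suc a ≤ n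
    a<n = subst (_≤ n) (ℕP.*-suc 2 c) 2[1+c]≤n
    IH = odd-product c (ℕP.≤-trans (ℕP.n≤1+n _) (ℕP.<⇒≤ a<n))
    last : ∀ y → prodℕ n (oddIndices (suc c)) y ≡ prodℕ n (oddIndices c) (gen n a y)
    last y = trans (cong (λ L → prodℕ n L y) (sym (LP.applyUpTo-∷ʳ _ c))) (prodℕ-∷ʳ (oddIndices c) a y)
    paired : ∀ y → 1 ≤ y → y ≤ 2 ℕ.* suc c → prodℕ n (oddIndices (suc c)) (+ y) ≡ + y + ε (+ y)
    paired y 1≤y y≤ with ≤-cases (subst (y ≤_) (ℕP.*-suc 2 c) y≤)
    ... | inj₁ y≤2c = begin
      prodℕ n (oddIndices (suc c)) (+ y)       ≡⟨ last (+ y) ⟩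
      prodℕ n (oddIndices c) (gen n a (+ y))   ≡⟨ cong (prodℕ n (oddIndices c)) (gen-elsewhere a y (s≤s z≤n) a<n yw y≢a y≢a+1) ⟩
      prodℕ n (oddIndices c) (+ y)             ≡⟨ proj₁ IH y 1≤y y≤2c ⟩
      + y + ε (+ y)                            ∎
      where
      yw = 1≤y , ℕP.≤-trans y≤2c (ℕP.≤-trans (ℕP.n≤1+n _) (ℕP.<⇒≤ a<n))
      y≢a = ℕP.<⇒≢ (s≤s y≤2c)
      y≢a+1 = ℕP.<⇒≢ (s≤s (ℕP.m≤n⇒m≤1+n y≤2c))
    ... | inj₂ (inj₁ refl) = begin
      prodℕ n (oddIndices (suc c)) (+ a)   ≡⟨ trans (last (+ a)) (cong (prodℕ n (oddIndices c)) (gen-at a)) ⟩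
      prodℕ n (oddIndices c) (+ suc a)     ≡⟨ proj₂ IH (suc a) (ℕP.n≤1+n _) a<n ⟩
      + suc a                              ≡⟨ ℤP.+-comm (+ a) 1ℤ ⟨
      + a + 1ℤ                             ≡⟨ cong (_+_ (+ a)) (ε-odd c) ⟨
      + a + ε (+ a)                        ∎
    ... | inj₂ (inj₂ refl) = begin
      prodℕ n (oddIndices (suc c)) (+ suc a)   ≡⟨ trans (last (+ suc a)) (cong (prodℕ n (oddIndices c)) (gen-at-suc a)) ⟩
      prodℕ n (oddIndices c) (+ a)             ≡⟨ proj₂ IH a ℕP.≤-refl (ℕP.<⇒≤ a<n) ⟩
      + a                                      ≡⟨ ring (+ a) ⟩
      + suc a + -1ℤ                            ≡⟨ cong (_+_ (+ suc a)) (ε-even c) ⟨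
      + suc a + ε (+ suc a)                    ∎
      where ring : ∀ a → a ≡ 1ℤ + a + -1ℤ
            ring = solve-∀
    fixed : ∀ y → 2 ℕ.* suc c < y → y ≤ n → prodℕ n (oddIndices (suc c)) (+ y) ≡ + y
    fixed y 2[1+c]<y y≤n = trans (last (+ y)) (trans (cong (prodℕ n (oddIndices c))
        (gen-elsewhere a y (s≤s z≤n) a<n (ℕP.≤-trans (s≤s z≤n) 2[1+c]<y , y≤n) (ℕP.<⇒≢ a<y ∘ sym) (ℕP.<⇒≢ a+1<y ∘ sym)))
      (proj₂ IH y (ℕP.<-trans (ℕP.n<1+n _) a<y) y≤n))
      where
      a+1<y : suc a < y
      a+1<y = subst (_< y) (ℕP.*-suc 2 c) 2[1+c]<y
      a<y : a < y
      a<y = ℕP.<-trans (ℕP.n<1+n a) a+1<y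

  private
    half : n ℕ./ 2 ≡ m
    half = trans (cong (ℕ._/ 2) (trans n≡2m (ℕP.*-comm 2 m))) (m*n/n≡m m 2)

    Θ⁺≡ : Θ⁺ n ≡ prodℕ n (oddIndices m)
    Θ⁺≡ = cong (prodℕ n) (trans (LP.map-upTo _ (n ℕ./ 2)) (cong (applyUpTo _) half))

    Θ⁻≡ : Θ⁻ n ≡ prodℕ n (map suc (oddIndices m))
    Θ⁻≡ = cong (prodℕ n) (trans (LP.map-∘ (upTo (n ℕ./ 2))) (cong (map suc) (trans (LP.map-upTo _ (n ℕ./ 2)) (cong (applyUpTo _) half))))

    2i+2≤n : ∀ {i} → i < m → suc (suc (2 ℕ.* i)) ≤ n
    2i+2≤n {i} i<m = subst₂ _≤_ (ℕP.*-suc 2 i) (sym n≡2m) (ℕP.*-monoʳ-≤ 2 i<m)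

    prodℕ-map-suc : ∀ L x → prodℕ n (map suc L) x ≡ prodℕ n L (x - 1ℤ) + 1ℤ
    prodℕ-map-suc []      x = sym (ring x)
      where ring : ∀ x → x - 1ℤ + 1ℤ ≡ x
            ring = solve-∀
    prodℕ-map-suc (a ∷ L) x = begin
      swap (+ suc a) (prodℕ n (map suc L) x)          ≡⟨ cong (swap (+ suc a)) (prodℕ-map-suc L x) ⟩
      swap (+ suc a) (y + 1ℤ)                         ≡⟨ cong (λ c → swap c (y + 1ℤ)) (ℤP.+-comm 1ℤ (+ a)) ⟩
      swap (+ a + 1ℤ) (y + 1ℤ)                        ≡⟨ swap-translate (+ a) 1ℤ (y + 1ℤ) ⟨
      swap (+ a) (y + 1ℤ - 1ℤ) + 1ℤ                   ≡⟨ cong (λ v → swap (+ a) v + 1ℤ) (ring y) ⟩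
      swap (+ a) y + 1ℤ                               ∎
      where
      y = prodℕ n L (x - 1ℤ)
      ring : ∀ y → y + 1ℤ - 1ℤ ≡ y
      ring = solve-∀

  periodic-Θ : ∀ κ → Periodic Θ[ κ ]
  periodic-Θ κ x = trans (cong (λ e → x + + n + κ * e) ε[x+n]≡ε[x]) (ring x (+ n) (κ * ε x))
    where
    ε[x+n]≡ε[x] : ε (x + + n) ≡ ε x
    ε[x+n]≡ε[x] = trans (cong (λ v → ε (x + v)) (trans (cong +_ (trans n≡2m (ℕP.*-comm 2 m))) (ℤP.pos-* m 2))) (ε-+-even x (+ m))
    ring : ∀ x n e → x + n + e ≡ x + e + n
    ring = solve-∀

  Θ⁺-formula : Θ⁺ n ≈ Θ[ 1ℤ ]
  Θ⁺-formula = subst (_≈ Θ[ 1ℤ ]) (sym Θ⁺≡) (periodic-ext _ _ (periodic-prodℕ (oddIndices m)) (periodic-Θ 1ℤ)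
    (λ y (1≤y , y≤n) → trans (proj₁ (odd-product m (ℕP.≤-reflexive (sym n≡2m))) y 1≤y (subst (y ≤_) n≡2m y≤n))
                             (cong (_+_ (+ y)) (sym (ℤP.*-identityˡ (ε (+ y)))))))

  Θ⁻-formula : Θ⁻ n ≈ Θ[ -1ℤ ]
  Θ⁻-formula x = begin
    Θ⁻ n x                                 ≡⟨ cong (λ f → f x) Θ⁻≡ ⟩
    prodℕ n (map suc (oddIndices m)) x     ≡⟨ prodℕ-map-suc (oddIndices m) x ⟩
    prodℕ n (oddIndices m) (x - 1ℤ) + 1ℤ   ≡⟨ cong (λ f → f (x - 1ℤ) + 1ℤ) Θ⁺≡ ⟨
    Θ⁺ n (x - 1ℤ) + 1ℤ                     ≡⟨ cong (_+ 1ℤ) (Θ⁺-formula (x - 1ℤ)) ⟩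
    x - 1ℤ + 1ℤ * ε (x - 1ℤ) + 1ℤ          ≡⟨ cong (λ e → x - 1ℤ + 1ℤ * e + 1ℤ) (ε-- x 1ℤ) ⟩
    x - 1ℤ + 1ℤ * - (ε x * 1ℤ) + 1ℤ        ≡⟨ ring x (ε x) ⟩
    x + -1ℤ * ε x                          ∎
    where ring : ∀ x e → x - 1ℤ + 1ℤ * - (e * 1ℤ) + 1ℤ ≡ x + -1ℤ * e
          ring = solve-∀

  aff-Θ⁺ : IsAff n (Θ⁺ n)
  aff-Θ⁺ = subst (IsAff n) (sym Θ⁺≡) (aff-prodℕ (All.applyUpTo⁺₁ _ m (λ i<m → s≤s z≤n , ℕP.≤-trans (ℕP.n≤1+n _) (2i+2≤n i<m))))

  aff-Θ⁻ : IsAff n (Θ⁻ n)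
  aff-Θ⁻ = subst (IsAff n) (sym Θ⁻≡) (aff-prodℕ (All.map⁺ (All.applyUpTo⁺₁ _ m (λ i<m → s≤s z≤n , 2i+2≤n i<m))))

module Automorphism (n : ℕ) .{{_ : NonZero n}} (2≤n : 2 ≤ n)
                    (τ : Perm → Perm) (aut : IsAutomorphism n τ) (ps : PreservesSimple n τ) where
  open Affine n 2≤n
  open Isometries
  open IsAutomorphism aut

  τ-id : τ id ≈ id
  τ-id x = IsAff.injective (closed id aff-id) (τ id x) x (sym (hom id id aff-id aff-id x))

  τ-gen-swap : ∀ i → InWindow i → Σ ℤ λ c → τ (gen n i) ≈ swap c
  τ-gen-swap (suc i) iw@(_ , i<n) =
    let k′ , τs≈ = proj₁ ps (gen n (suc i)) (aff-gen (suc i) iw) (fromℕ< i<n , λ x → cong (λ j → gen n (suc j) x) (sym (FP.toℕ-fromℕ< i<n)))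
    in + suc (toℕ k′) , τs≈

  τ-gen-adjacent : ∀ i → 1 ≤ i → suc i ≤ n → ∀ {a b} → τ (gen n i) ≈ swap a → τ (gen n (suc i)) ≈ swap b →
    b ≡ₘ 1ℤ + a ⊎ a ≡ₘ 1ℤ + b
  τ-gen-adjacent i 1≤i i<n {a} {b} τsᵢ τsᵢ₊₁ with b ≡ₘ? 1ℤ + a | a ≡ₘ? 1ℤ + b
  ... | yes p | _     = inj₁ p
  ... | no _  | yes q = inj₂ q
  ... | no ¬p | no ¬q = contradiction (commute (+ suc i)) (swap-1+-noncomm (+ i))
    where
    sᵢ = gen n i
    sᵢ₊₁ = gen n (suc i)
    aᵢ = aff-gen i (1≤i , ℕP.<⇒≤ i<n)
    aᵢ₊₁ = aff-gen (suc i) (s≤s z≤n , i<n)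
    commute : (sᵢ ∘ sᵢ₊₁) ≈ (sᵢ₊₁ ∘ sᵢ)
    commute = injective (sᵢ ∘ sᵢ₊₁) (sᵢ₊₁ ∘ sᵢ) (aff-∘gen (suc i) (s≤s z≤n , i<n) aᵢ) (aff-∘gen i (1≤i , ℕP.<⇒≤ i<n) aᵢ₊₁)
      λ x → begin
      τ (sᵢ ∘ sᵢ₊₁) x               ≡⟨ hom sᵢ sᵢ₊₁ aᵢ aᵢ₊₁ x ⟩
      τ sᵢ (τ sᵢ₊₁ x)               ≡⟨ trans (τsᵢ _) (cong (swap a) (τsᵢ₊₁ x)) ⟩
      swap a (swap b x)             ≡⟨ swap-comm a b (¬p , ¬q) x ⟩
      swap b (swap a x)             ≡⟨ trans (τsᵢ₊₁ _) (cong (swap b) (τsᵢ x)) ⟨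
      τ sᵢ₊₁ (τ sᵢ x)               ≡⟨ hom sᵢ₊₁ sᵢ aᵢ₊₁ aᵢ x ⟨
      τ (sᵢ₊₁ ∘ sᵢ) x               ∎

  τ-gen-distinct : ∀ i → 1 ≤ i → suc (suc i) ≤ n → ∀ {a b} → τ (gen n i) ≈ swap a → τ (gen n (suc (suc i))) ≈ swap b → ¬ b ≡ₘ a
  τ-gen-distinct i 1≤i i+2≤n {a} {b} τsᵢ τsᵢ₊₂ b≡a = ℤP.<⇒≱ (ℤP.+-monoʳ-< (+ i) (ℤ.+<+ (s≤s z≤n))) i+1≤i
    where
    iw : InWindow i
    iw = 1≤i , ℕP.≤-trans (ℕP.n≤1+n _) (ℕP.≤-trans (ℕP.n≤1+n _) i+2≤n)
    i+2w : InWindow (suc (suc i))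
    i+2w = s≤s z≤n , i+2≤n
    same : gen n (suc (suc i)) ≈ gen n i
    same = injective _ _ (aff-gen _ i+2w) (aff-gen i iw) (λ x → trans (τsᵢ₊₂ x) (trans (swap-resp-≡ₘ b≡a x) (sym (τsᵢ x))))
    i+1≤i : + i + 1ℤ ℤ.≤ + i + 0ℤ
    i+1≤i = subst₂ ℤ._≤_ (trans (same (+ i)) (swap-at {+ i} {+ i} ≡ₘ-refl)) (sym (ℤP.+-identityʳ (+ i)))
                (swap-≤ {+ suc (suc i)} {+ i} (window-≢ₘ iw i+2w (ℕP.<⇒≢ (s≤s (ℕP.n≤1+n i)))))

  private
    Sign : ℤ → Set
    Sign e = e ≡ 1ℤ ⊎ e ≡ -1ℤ

    adjacent-± : ∀ {e x c} → Sign e → c ≡ₘ 1ℤ + x ⊎ x ≡ₘ 1ℤ + c → c ≡ₘ x + e ⊎ c ≡ₘ x - e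
    adjacent-± {x = x} {c} (inj₁ refl) (inj₁ p) = inj₁ (subst (c ≡ₘ_) (ℤP.+-comm 1ℤ x) p)
    adjacent-± {x = x} {c} (inj₁ refl) (inj₂ q) = inj₂ (≡ₘ-by-difference c (x - 1ℤ) (≡ₘ-sym q) (ring c x))
      where ring : ∀ c x → c - (x - 1ℤ) ≡ 1ℤ + c - x
            ring = solve-∀
    adjacent-± {x = x} {c} (inj₂ refl) (inj₁ p) = inj₂ (subst (c ≡ₘ_) (ring x) p)
      where ring : ∀ x → 1ℤ + x ≡ x - -1ℤ
            ring = solve-∀
    adjacent-± {x = x} {c} (inj₂ refl) (inj₂ q) = inj₁ (≡ₘ-by-difference c (x + -1ℤ) (≡ₘ-sym q) (ring c x))
      where ring : ∀ c x → c - (x + -1ℤ) ≡ 1ℤ + c - x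
            ring = solve-∀

    -- the swap indices of τ s₁, τ s₂, … advance by the same step e = ±1 modulo n
    module Progression (a e : ℤ) (sign : Sign e)
                       (τs₁ : τ (gen n 1) ≈ swap a) (τs₂ : τ (gen n 2) ≈ swap (a + e)) where
      term : ℕ → ℤ
      term i = a + + i * e

      pair : ∀ i → suc (suc i) ≤ n → τ (gen n (suc i)) ≈ swap (term i) × τ (gen n (suc (suc i))) ≈ swap (term (suc i))
      pair zero    _ = (λ x → trans (τs₁ x) (cong (λ c → swap c x) (l₀ a e))) , (λ x → trans (τs₂ x) (cong (λ c → swap c x) (ring₁ a e)))
        where
        l₀ : ∀ a e → a ≡ a + + 0 * e
        l₀ = solve-∀
        ring₁ : ∀ a e → a + e ≡ a + + 1 * e
        ring₁ = solve-∀
      pair (suc i) i+3≤n with pair i (ℕP.<⇒≤ i+3≤n) | τ-gen-swap (suc (suc (suc i))) (s≤s z≤n , i+3≤n)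
      ... | τsᵢ , τsᵢ₊₁ | c , τsᵢ₊₂ =
        τsᵢ₊₁ , next (adjacent-± {x = term (suc i)} sign (τ-gen-adjacent (suc (suc i)) (s≤s z≤n) i+3≤n τsᵢ₊₁ τsᵢ₊₂))
        where
        next : c ≡ₘ term (suc i) + e ⊎ c ≡ₘ term (suc i) - e → τ (gen n (suc (suc (suc i)))) ≈ swap (term (suc (suc i)))
        next (inj₁ p) x = trans (τsᵢ₊₂ x) (swap-resp-≡ₘ (subst (c ≡ₘ_) (ring a (+ suc i) e) p) x)
          where ring : ∀ a k e → a + k * e + e ≡ a + (1ℤ + k) * e
                ring = solve-∀
        next (inj₂ q) = contradiction (subst (c ≡ₘ_) (ring a (+ i) e) q) (τ-gen-distinct (suc i) (s≤s z≤n) i+3≤n τsᵢ τsᵢ₊₂)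
          where ring : ∀ a k e → a + (1ℤ + k) * e - e ≡ a + k * e
                ring = solve-∀

      all : ∀ i → InWindow (suc i) → τ (gen n (suc i)) ≈ swap (term i)
      all zero    _            = proj₁ (pair zero 2≤n)
      all (suc i) (_ , i+2≤n) = proj₂ (pair i i+2≤n)

  τ-gen-isometry : Σ Isometry λ σ → ∀ i → InWindow i → τ (gen n i) ≈ (⟦ σ ⟧ ∘ gen n i ∘ ⟦ σ ⟧⁻¹)
  τ-gen-isometry with τ-gen-swap 1 (ℕP.≤-refl , ℕP.≤-trans (s≤s z≤n) 2≤n) | τ-gen-swap 2 (s≤s z≤n , 2≤n)
  ... | a , τs₁ | b , τs₂ with τ-gen-adjacent 1 ℕP.≤-refl 2≤n {a} {b} τs₁ τs₂
  ... | inj₁ b≡1+a = translation (a - 1ℤ) , conj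
    where
    b≡a+1 : b ≡ₘ a + 1ℤ
    b≡a+1 = subst (b ≡ₘ_) (ℤP.+-comm 1ℤ a) b≡1+a
    open Progression a 1ℤ (inj₁ refl) τs₁ (λ y → trans (τs₂ y) (swap-resp-≡ₘ b≡a+1 y))
    conj : ∀ i → InWindow i → τ (gen n i) ≈ (⟦ translation (a - 1ℤ) ⟧ ∘ gen n i ∘ ⟦ translation (a - 1ℤ) ⟧⁻¹)
    conj (suc i) iw x = trans (all i iw x) (trans (cong (λ c → swap c x) (ring a (+ i))) (sym (swap-translate (+ suc i) (a - 1ℤ) x)))
      where ring : ∀ a i → a + i * 1ℤ ≡ 1ℤ + i + (a - 1ℤ)
            ring = solve-∀
  ... | inj₂ a≡1+b = reflection (a + + 2) , conj
    where
    b≡a-1 : b ≡ₘ a + -1ℤ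
    b≡a-1 = ≡ₘ-by-difference b (a + -1ℤ) (≡ₘ-sym a≡1+b) (ring a b)
      where ring : ∀ a b → b - (a + -1ℤ) ≡ 1ℤ + b - a
            ring = solve-∀
    open Progression a -1ℤ (inj₂ refl) τs₁ (λ y → trans (τs₂ y) (swap-resp-≡ₘ b≡a-1 y))
    conj : ∀ i → InWindow i → τ (gen n i) ≈ (⟦ reflection (a + + 2) ⟧ ∘ gen n i ∘ ⟦ reflection (a + + 2) ⟧⁻¹)
    conj (suc i) iw x = trans (all i iw x) (trans (cong (λ c → swap c x) (ring a (+ i))) (sym (swap-reflect (+ suc i) (a + + 2) x)))
      where ring : ∀ a i → a + i * -1ℤ ≡ a + + 2 - (1ℤ + (1ℤ + i))
            ring = solve-∀

  τ-isometry : Σ Isometry λ σ → ∀ w → IsAff n w → τ w ≈ (⟦ σ ⟧ ∘ w ∘ ⟦ σ ⟧⁻¹)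
  τ-isometry = σ , λ w aw x →
    let ws , ws≈w = generated-by-words w aw
    in trans (respects w (wordProd n ws) aw (aff-wordProd ws) (sym ∘ ws≈w) x)
             (trans (on-words ws x) (cong ⟦ σ ⟧ (ws≈w (⟦ σ ⟧⁻¹ x))))
    where
    σ = proj₁ τ-gen-isometry
    on-gens = proj₂ τ-gen-isometry
    on-words : ∀ ws → τ (wordProd n ws) ≈ (⟦ σ ⟧ ∘ wordProd n ws ∘ ⟦ σ ⟧⁻¹)
    on-words []       x = trans (τ-id x) (sym (⟦⟧⁻¹-inverseʳ σ x))
    on-words (k ∷ ws) x = begin
      τ (gen n i ∘ wordProd n ws) x                           ≡⟨ hom (gen n i) (wordProd n ws) (aff-gen i iw) (aff-wordProd ws) x ⟩
      τ (gen n i) (τ (wordProd n ws) x)                       ≡⟨ on-gens i iw _ ⟩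
      ⟦ σ ⟧ (gen n i (⟦ σ ⟧⁻¹ (τ (wordProd n ws) x)))         ≡⟨ cong (λ y → ⟦ σ ⟧ (gen n i (⟦ σ ⟧⁻¹ y))) (on-words ws x) ⟩
      ⟦ σ ⟧ (gen n i (⟦ σ ⟧⁻¹ (⟦ σ ⟧ (wordProd n ws (⟦ σ ⟧⁻¹ x))))) ≡⟨ cong (⟦ σ ⟧ ∘ gen n i) (⟦⟧⁻¹-inverseˡ σ _) ⟩
      ⟦ σ ⟧ (gen n i (wordProd n ws (⟦ σ ⟧⁻¹ x)))             ∎
      where
      i = suc (toℕ k)
      iw = index-window k

module Transport (n : ℕ) .{{_ : NonZero n}} (2≤n : 2 ≤ n) (m : ℕ) (n≡2m : n ≡ 2 ℕ.* m)
            (τ : Perm → Perm) (aut : IsAutomorphism n τ) (ps : PreservesSimple n τ) where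
  open Affine n 2≤n
  open Theta n 2≤n m n≡2m
  open Automorphism n 2≤n τ aut ps
  open Isometries
  open IsAutomorphism aut

  private
    σ : Isometry
    σ = proj₁ τ-isometry

    τ≈conjugate : ∀ w → IsAff n w → τ w ≈ (⟦ σ ⟧ ∘ w ∘ ⟦ σ ⟧⁻¹)
    τ≈conjugate = proj₂ τ-isometry

  τ-preserves-FPF : ∀ z → IsFPF n z → IsFPF n (τ z)
  τ-preserves-FPF z (az , involutive , fpf) =
    closed z az ,
    (λ i → trans (τ≈conjugate z az _)
             (trans (cong (⟦ σ ⟧ ∘ z ∘ ⟦ σ ⟧⁻¹) (τ≈conjugate z az i)) (conjugate-involutive σ {z} involutive i))) ,
    (λ i e → conjugate-fixed-point-free σ {z} fpf i (trans (sym (τ≈conjugate z az i)) e))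

  private
    τΘ[_] : ∀ κ {Θ} → IsAff n Θ → Θ ≈ Θ[ κ ] → τ Θ ≈ Θ[ orientation σ * κ ]
    τΘ[ κ ] aΘ Θ≈ x = trans (τ≈conjugate _ aΘ x) (trans (cong ⟦ σ ⟧ (Θ≈ _)) (Θ-conjugate σ κ x))

  ΘAction : Set
  ΘAction = (τ (Θ⁺ n) ≈ Θ⁺ n × τ (Θ⁻ n) ≈ Θ⁻ n) ⊎ (τ (Θ⁺ n) ≈ Θ⁻ n × τ (Θ⁻ n) ≈ Θ⁺ n)

  τ-Θ : ΘAction
  τ-Θ = by-orientation (orientation-±1 σ)
    where
    τΘ⁺ : ∀ o → orientation σ ≡ o → τ (Θ⁺ n) ≈ Θ[ o * 1ℤ ]
    τΘ⁺ o e x = trans (τΘ[ 1ℤ ] aff-Θ⁺ Θ⁺-formula x) (cong (λ o → Θ[ o * 1ℤ ] x) e)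
    τΘ⁻ : ∀ o → orientation σ ≡ o → τ (Θ⁻ n) ≈ Θ[ o * -1ℤ ]
    τΘ⁻ o e x = trans (τΘ[ -1ℤ ] aff-Θ⁻ Θ⁻-formula x) (cong (λ o → Θ[ o * -1ℤ ] x) e)
    by-orientation : orientation σ ≡ 1ℤ ⊎ orientation σ ≡ -1ℤ → ΘAction
    by-orientation (inj₁ e) = inj₁ ((λ x → trans (τΘ⁺ 1ℤ e x) (sym (Θ⁺-formula x))) , (λ x → trans (τΘ⁻ 1ℤ e x) (sym (Θ⁻-formula x))))
    by-orientation (inj₂ e) = inj₂ ((λ x → trans (τΘ⁺ -1ℤ e x) (sym (Θ⁻-formula x))) , (λ x → trans (τΘ⁻ -1ℤ e x) (sym (Θ⁺-formula x))))

  ConjBy-resp-≈ : ∀ {Θ Θ′ w z} → Θ ≈ Θ′ → ConjBy Θ w z → ConjBy Θ′ w z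
  ConjBy-resp-≈ {w = w} Θ≈Θ′ c x = trans (sym (Θ≈Θ′ (w x))) (c x)

  τ-ConjBy : ∀ {Θ w z} → IsAff n Θ → IsAff n w → IsAff n z → ConjBy Θ w z → ConjBy (τ Θ) (τ w) (τ z)
  τ-ConjBy {Θ} {w} {z} aΘ aw az c x = begin
    τ Θ (τ w x)      ≡⟨ hom Θ w aΘ aw x ⟨
    τ (Θ ∘ w) x      ≡⟨ respects (Θ ∘ w) (w ∘ z) (aff-∘ aΘ aw) (aff-∘ aw az) c x ⟩
    τ (w ∘ z) x      ≡⟨ hom w z aw az x ⟩
    τ w (τ z x)      ∎

  τ-ConjBy⁻¹ : ∀ {Θ w z} → IsAff n Θ → IsAff n w → IsAff n z → ConjBy (τ Θ) (τ w) (τ z) → ConjBy Θ w z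
  τ-ConjBy⁻¹ {Θ} {w} {z} aΘ aw az c = injective (Θ ∘ w) (w ∘ z) (aff-∘ aΘ aw) (aff-∘ aw az) λ x → begin
    τ (Θ ∘ w) x      ≡⟨ hom Θ w aΘ aw x ⟩
    τ Θ (τ w x)      ≡⟨ c x ⟩
    τ w (τ z x)      ≡⟨ hom w z aw az x ⟨
    τ (w ∘ z) x      ∎

  τ-InConjSet : ∀ {z π} → IsAff n z → InConjSet n z π → InConjSet n (τ z) (τ π)
  τ-InConjSet {z} {π} az (aπ , c) = closed π aπ , image c τ-Θ
    where
    image : ConjBy (Θ⁺ n) π z ⊎ ConjBy (Θ⁻ n) π z → ΘAction → ConjBy (Θ⁺ n) (τ π) (τ z) ⊎ ConjBy (Θ⁻ n) (τ π) (τ z)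
    image (inj₁ c⁺) (inj₁ (fix⁺ , _)) = inj₁ (ConjBy-resp-≈ fix⁺ (τ-ConjBy aff-Θ⁺ aπ az c⁺))
    image (inj₂ c⁻) (inj₁ (_ , fix⁻)) = inj₂ (ConjBy-resp-≈ fix⁻ (τ-ConjBy aff-Θ⁻ aπ az c⁻))
    image (inj₁ c⁺) (inj₂ (swap⁺ , _)) = inj₂ (ConjBy-resp-≈ swap⁺ (τ-ConjBy aff-Θ⁺ aπ az c⁺))
    image (inj₂ c⁻) (inj₂ (_ , swap⁻)) = inj₁ (ConjBy-resp-≈ swap⁻ (τ-ConjBy aff-Θ⁻ aπ az c⁻))

  τ-InConjSet⁻¹ : ∀ {z w} → IsAff n z → InConjSet n (τ z) w → Σ Perm λ π → InConjSet n z π × w ≈ τ π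
  τ-InConjSet⁻¹ {z} {w} az (aw , c) = π , (aπ , preimage c τ-Θ) , λ x → sym (τπ≈w x)
    where
    π = proj₁ (surjective w aw)
    aπ = proj₁ (proj₂ (surjective w aw))
    τπ≈w = proj₂ (proj₂ (surjective w aw))
    pull : ∀ {Θ Θ′} → IsAff n Θ → τ Θ ≈ Θ′ → ConjBy Θ′ w (τ z) → ConjBy Θ π z
    pull {Θ} {Θ′} aΘ τΘ≈Θ′ c′ = τ-ConjBy⁻¹ aΘ aπ az λ x →
      trans (τΘ≈Θ′ _) (trans (cong Θ′ (τπ≈w x)) (trans (c′ x) (sym (τπ≈w _))))
    preimage : ConjBy (Θ⁺ n) w (τ z) ⊎ ConjBy (Θ⁻ n) w (τ z) → ΘAction → ConjBy (Θ⁺ n) π z ⊎ ConjBy (Θ⁻ n) π z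
    preimage (inj₁ c⁺) (inj₁ (fix⁺ , _)) = inj₁ (pull aff-Θ⁺ fix⁺ c⁺)
    preimage (inj₂ c⁻) (inj₁ (_ , fix⁻)) = inj₂ (pull aff-Θ⁻ fix⁻ c⁻)
    preimage (inj₁ c⁺) (inj₂ (_ , swap⁻)) = inj₂ (pull aff-Θ⁻ swap⁻ c⁺)
    preimage (inj₂ c⁻) (inj₂ (swap⁺ , _)) = inj₁ (pull aff-Θ⁺ swap⁺ c⁻)

  private
    simple : (k : Fin n) → IsSimple n (gen n (suc (toℕ k)))
    simple k = k , λ _ → refl

    image : Fin n → Fin n
    image k = proj₁ (proj₁ ps (gen n (suc (toℕ k))) (aff-gen (suc (toℕ k)) (index-window k)) (simple k))

    τ-gen-image : ∀ k → τ (gen n (suc (toℕ k))) ≈ gen n (suc (toℕ (image k)))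
    τ-gen-image k = proj₂ (proj₁ ps (gen n (suc (toℕ k))) (aff-gen (suc (toℕ k)) (index-window k)) (simple k))

    preimage-of : (k : Fin n) → Σ Perm λ f → IsAff n f × IsSimple n f × (τ f ≈ gen n (suc (toℕ k)))
    preimage-of k = proj₂ ps (gen n (suc (toℕ k))) (simple k)

    preimage : Fin n → Fin n
    preimage k = proj₁ (proj₁ (proj₂ (proj₂ (preimage-of k))))

    τ-gen-preimage : ∀ k → τ (gen n (suc (toℕ (preimage k)))) ≈ gen n (suc (toℕ k))
    τ-gen-preimage k x with preimage-of k
    ... | f , af , (k′ , f≈gen) , τf≈gen =
      trans (respects _ f (aff-gen (suc (toℕ k′)) (index-window k′)) af (sym ∘ f≈gen) x) (τf≈gen x)

    τ-wordProd : ∀ ws → τ (wordProd n ws) ≈ wordProd n (map image ws)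
    τ-wordProd []       x = τ-id x
    τ-wordProd (k ∷ ws) x = trans (hom _ (wordProd n ws) (aff-gen (suc (toℕ k)) (index-window k)) (aff-wordProd ws) x)
                                  (trans (τ-gen-image k _) (cong (gen n _) (τ-wordProd ws x)))

    τ-wordProd-preimage : ∀ ws → τ (wordProd n (map preimage ws)) ≈ wordProd n ws
    τ-wordProd-preimage []       x = τ-id x
    τ-wordProd-preimage (k ∷ ws) x =
      trans (hom _ (wordProd n (map preimage ws)) (aff-gen (suc (toℕ (preimage k))) (index-window (preimage k)))
                 (aff-wordProd (map preimage ws)) x)
            (trans (τ-gen-preimage k _) (cong (gen n _) (τ-wordProd-preimage ws x)))

  HasWord-resp-≈ : ∀ {w v k} → w ≈ v → HasWord n w k → HasWord n v k
  HasWord-resp-≈ w≈v (ws , len , ws≈w) = ws , len , λ x → trans (ws≈w x) (w≈v x)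

  τ-HasWord : ∀ {w k} → IsAff n w → HasWord n w k → HasWord n (τ w) k
  τ-HasWord {w} aw (ws , len , ws≈w) =
    map image ws , trans (LP.length-map image ws) len ,
    λ x → trans (sym (τ-wordProd ws x)) (respects (wordProd n ws) w (aff-wordProd ws) aw ws≈w x)

  τ-HasWord⁻¹ : ∀ {w k} → IsAff n w → HasWord n (τ w) k → HasWord n w k
  τ-HasWord⁻¹ {w} aw (ws , len , ws≈τw) =
    map preimage ws , trans (LP.length-map preimage ws) len ,
    injective (wordProd n (map preimage ws)) w (aff-wordProd (map preimage ws)) aw (λ x → trans (τ-wordProd-preimage ws x) (ws≈τw x))

  τ-InAtoms : ∀ z → IsFPF n z → ∀ π → InAtoms n z π → InAtoms n (τ z) (τ π)
  τ-InAtoms z (az , _) π (π∈ , π-min) = τ-InConjSet az π∈ , shortest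
    where
    shortest : ∀ v → InConjSet n (τ z) v → LenLe n (τ π) v
    shortest v v∈ k hv with τ-InConjSet⁻¹ az v∈
    ... | π′ , π′∈ , v≈τπ′ with π-min π′ π′∈ k (τ-HasWord⁻¹ (proj₁ π′∈) (HasWord-resp-≈ v≈τπ′ hv))
    ...   | k′ , k′≤k , hπ = k′ , k′≤k , τ-HasWord (proj₁ π∈) hπ

  τ-InAtoms⁻¹ : ∀ z → IsFPF n z → ∀ w → InAtoms n (τ z) w → Σ Perm λ π → InAtoms n z π × (w ≈ τ π)
  τ-InAtoms⁻¹ z (az , _) w (w∈ , w-min) with τ-InConjSet⁻¹ az w∈
  ... | π , π∈ , w≈τπ = π , (π∈ , shortest) , w≈τπ
    where
    shortest : ∀ v → InConjSet n z v → LenLe n π v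
    shortest v v∈ k hv with w-min (τ v) (τ-InConjSet az v∈) k (τ-HasWord (proj₁ v∈) hv)
    ... | k′ , k′≤k , hw = k′ , k′≤k , τ-HasWord⁻¹ (proj₁ π∈) (HasWord-resp-≈ w≈τπ hw)

proposition3p13 : (n : ℕ) .{{_ : NonZero n}} → 2 ≤ n → 2 ∣ n →
    (τ : Perm → Perm) → IsAutomorphism n τ → PreservesSimple n τ →
    (∀ z → IsFPF n z → IsFPF n (τ z)) ×
    (∀ z → IsFPF n z →
      (∀ w → InAtoms n (τ z) w → Σ Perm λ π → InAtoms n z π × (w ≈ τ π)) ×
      (∀ π → InAtoms n z π → InAtoms n (τ z) (τ π)))
proposition3p13 n 2≤n (divides m n≡m*2) τ aut ps =
  τ-preserves-FPF , λ z z-fpf → τ-InAtoms⁻¹ z z-fpf , τ-InAtoms z z-fpf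
  where open Transport n 2≤n m (trans n≡m*2 (ℕP.*-comm m 2)) τ aut ps
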